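{- Let $r\ge3$ and let $\mathcal{T}_n$ be the uniform random $(r-1)$-tournament on $[n]$. Then, as $n\to\infty$: (i) $\mathbb{E}[t_{\mathcal{K}_r}(\mathcal{G}(\mathcal{T}_n))]=2^{1-r}+o(1)$; (ii) if $\mathcal{H}$ is a fixed $r$-uniform hypergraph whose edges admit an ordering $e_1,\dots,e_m$ such that, for each $i$, the family $\{e_i\cap e_j:j<i\}$ contains at most one set of size $r-1$, then $\mathbb{E}[t_{\mathcal{H}}(\mathcal{G}(\mathcal{T}_n))]=2^{(1-r)e(\mathcal{H})}+o(1)$.
   Context: An $(r-1)$-tournament on $[n]$ assigns to every $(r-1)$-subset $T\subseteq[n]$ an orientation $\sigma(T)$: a map from the orderings of $T$ to $\{+1,-1\}$ such that two orderings differing by an odd permutation receive opposite values (so $\sigma(T)$ is determined by its value $\pm1$ on the increasing ordering). In the uniform random $(r-1)$-tournament, these values are chosen independently and uniformly for all $T$. For $S=T\setminus\{v\}$ with $v\in T$, the $T$-sign $\sigma_T(S)$ is the value of $\sigma(T)$ on the ordering that lists $S$ in increasing order followed by $v$. For an $r$-set $R\subseteq[n]$ and an $(r-2)$-subset $S\subseteq R$, the $R$-weight of $S$ is $\sum_T\sigma_T(S)$ over the two $(r-1)$-sets $T$ with $S\subset T\subset R$. $\mathcal{G}(\mathcal{T}_n)$ is the $r$-graph on $[n]$ whose edges are the $r$-sets $R$ such that every $(r-2)$-subset of $R$ has $R$-weight $0$. For an $r$-graph $G$ on $[n]$ and an $r$-graph $\mathcal{H}$, $t_{\mathcal{H}}(G)$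 is the number of maps $\varphi:V(\mathcal{H})\to[n]$ with $\varphi(e)\in E(G)$ for all $e\in E(\mathcal{H})$, divided by $n^{|V(\mathcal{H})|}$; $\mathcal{K}_r$ is the single-edge $r$-graph. -}

module Defs where

open import Data.Bool using (Bool; true; false; _∧_; _∨_; not)
import Data.Bool.Properties
open import Data.Fin.Subset.Properties using (_⊆?_)
open import Data.Nat as ℕ using (ℕ; zero; suc; _∸_; _^_)
open import Data.Integer as ℤ using (ℤ; +_)
open import Data.Rational as ℚ using (ℚ; ½; 0ℚ; 1ℚ)
open import Data.Fin using (Fin; zero; suc; _<_)
open import Data.Fin.Subset using (Subset; ∣_∣; _∩_; _∪_; ⁅_⁆; ⊥; _⊆_; _∉_)
open import Data.Fin.Subset.Properties using (_∈?_)
open import Data.Vec using (Vec; []; _∷_)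
import Data.Vec.Properties as VecP
open import Data.List as List using (List; []; _∷_; _++_; map; filter; length; concatMap; foldr; lookup)
open import Data.List.Relation.Unary.All using (All)
open import Data.List.Relation.Unary.Unique.Propositional using (Unique)
open import Data.List.Relation.Binary.Permutation.Propositional using (_↭_)
open import Data.Product using (_×_; ∃; ∃-syntax; _,_)
open import Relation.Binary.PropositionalEquality using (_≡_)
open import Relation.Nullary using (Dec; yes; no; ¬_)
open import Relation.Nullary.Decidable using (⌊_⌋)
import Data.Bool.Properties as BoolP
open import Function using (_∘_)

allSubsets : (n : ℕ) → List (Subset n)
allSubsets zero = [] ∷ []
allSubsets (suc n) = map (true ∷_) (allSubsets n) ++ map (false ∷_) (allSubsets n)

kSubsets : (n k : ℕ) → List (Subset n)
kSubsets n k = filter (λ p → ∣ p ∣ ℕ.≟ k) (allSubsets n)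

elems : {n : ℕ} → Subset n → List (Fin n)
elems [] = []
elems (true ∷ p) = zero ∷ map suc (elems p)
elems (false ∷ p) = map suc (elems p)

allMaps : (k n : ℕ) → List (Vec (Fin n) k)
allMaps zero n = [] ∷ []
allMaps (suc k) n = concatMap (λ x → map (x ∷_) (allMaps k n)) (List.allFin n)

-- (r-1)-tournaments.  σ T ∈ {true = +1, false = -1} is the value of the
-- orientation σ(T) on the increasing ordering of T (values on sets
-- that are not (r-1)-sets are irrelevant).

Tournament : ℕ → Set
Tournament n = Subset n → Bool

sgn : Bool → ℤ
sgn true = + 1
sgn false = ℤ.- (+ 1)

inversions : {n : ℕ} → List (Fin n) → ℕ
inversions [] = 0
inversions (x ∷ xs) = length (filter (λ y → y Data.Fin.<? x) xs) ℕ.+ inversions xs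

parity : ℕ → ℤ
parity zero = + 1
parity (suc k) = ℤ.- parity k

-- value of the orientation σ(T) on an ordering w of T: the value on the
-- increasing ordering times the sign of the permutation taking the
-- increasing ordering to w (= (-1)^{number of inversions of w}).
orientVal : {n : ℕ} → Tournament n → Subset n → List (Fin n) → ℤ
orientVal σ T w = sgn (σ T) ℤ.* parity (inversions w)

tSign : {n : ℕ} → Tournament n → Subset n → Fin n → ℤ
tSign σ S v = orientVal σ (S ∪ ⁅ v ⁆) (elems S ++ (v ∷ []))

-- R-weight of S ⊆ R, |S| = r-2: sum of σ_T(S) over T = S ∪ {v}, v ∈ R ∖ S
-- (these are exactly the (r-1)-sets T with S ⊂ T ⊂ R)
rWeight : {n : ℕ} → Tournament n → Subset n → Subset n → ℤ
rWeight σ R S =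
  foldr ℤ._+_ (+ 0)
    (map (tSign σ S) (filter (λ v → Relation.Nullary.¬? (v ∈? S)) (elems R)))
  where import Relation.Nullary

allB : {A : Set} → (A → Bool) → List A → Bool
allB p [] = true
allB p (x ∷ xs) = p x ∧ allB p xs

-- R is an edge of G(T): R is an r-set and every (r-2)-subset S of R
-- has R-weight 0 (Boolean-valued, so that it can be counted)
isEdgeG : {n : ℕ} (r : ℕ) → Tournament n → Subset n → Bool
isEdgeG {n} r σ R =
  ⌊ ∣ R ∣ ℕ.≟ r ⌋ ∧
  allB (λ S → not ⌊ S ⊆? R ⌋ ∨ ⌊ rWeight σ R S ℤ.≟ + 0 ⌋) (kSubsets n (r ∸ 2))

record Hypergraph (r : ℕ) : Set where
  field
    nV     : ℕ
    edges  : List (Subset nV)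
    unique : Unique edges
    unif   : All (λ e → ∣ e ∣ ≡ r) edges
open Hypergraph public

eH : {r : ℕ} → Hypergraph r → ℕ
eH H = length (edges H)

Kr : (r : ℕ) → Hypergraph r
Kr r = record { nV = r ; edges = ⊤s ∷ [] ; unique = All.[] AP.∷ AP.[] ; unif = ∣⊤∣≡n r All.∷ All.[] }
  where
  open import Data.Fin.Subset using () renaming (⊤ to ⊤s)
  open import Data.Fin.Subset.Properties using (∣⊤∣≡n)
  import Data.List.Relation.Unary.All as All
  import Data.List.Relation.Unary.AllPairs as AP

image : {k n : ℕ} → Vec (Fin n) k → Subset k → Subset n
image φ e = foldr _∪_ ⊥ (map (λ v → ⁅ Data.Vec.lookup φ v ⁆) (elems e))

-- a/b as a rational (0 if b = 0; only used with b ≥ 1)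
divℕ : ℕ → ℕ → ℚ
divℕ a zero = 0ℚ
divℕ a (suc b) = (+ a) ℚ./ suc b

homDensity : {r n : ℕ} → Hypergraph r → (Subset n → Bool) → ℚ
homDensity {n = n} H G =
  divℕ (length (filter (λ φ → T? (allB (λ e → G (image φ e)) (edges H))) (allMaps (nV H) n)))
       (n ^ nV H)
  where
  T? : (b : Bool) → Dec (b ≡ true)
  T? b = b Data.Bool.Properties.≟ true

-- Expectation over the uniform random (r-1)-tournament on [n]: the
-- values σ(T) for T ranging over the (r-1)-subsets are independent and
-- uniform in {±1}.

update : {n : ℕ} → Tournament n → Subset n → Bool → Tournament n
update σ T b S with VecP.≡-dec BoolP._≟_ S T
... | yes _ = b
... | no _ = σ S

avgOver : {n : ℕ} → List (Subset n) → (Tournament n → ℚ) → ℚ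
avgOver [] f = f (λ _ → true)
avgOver (T ∷ L) f =
  ½ ℚ.* (avgOver L (λ σ → f (update σ T true)) ℚ.+ avgOver L (λ σ → f (update σ T false)))

Expect : (r n : ℕ) → (Tournament n → ℚ) → ℚ
Expect r n f = avgOver (kSubsets n (r ∸ 1)) f

expectedDensity : (r : ℕ) → Hypergraph r → ℕ → ℚ
expectedDensity r H n = Expect r n (λ σ → homDensity H (isEdgeG r σ))

-- (1/2)^k  (so 2^{(1-r) m} = halfPow ((r-1) * m))
halfPow : ℕ → ℚ
halfPow zero = 1ℚ
halfPow (suc k) = ½ ℚ.* halfPow k

ConvergesTo : (ℕ → ℚ) → ℚ → Set
ConvergesTo a L = ∀ (ε : ℚ) → 0ℚ ℚ.< ε → ∃[ N ] (∀ n → N ℕ.≤ n → ℚ.∣ a n ℚ.- L ∣ ℚ.< ε)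

GoodOrder : {k : ℕ} (r : ℕ) → List (Subset k) → Set
GoodOrder r es =
  ∀ (i j j' : Fin (length es)) → j < i → j' < i →
    ∣ lookup es i ∩ lookup es j ∣ ≡ r ∸ 1 →
    ∣ lookup es i ∩ lookup es j' ∣ ≡ r ∸ 1 →
    lookup es i ∩ lookup es j ≡ lookup es i ∩ lookup es j'

AdmitsGoodOrder : {r : ℕ} → Hypergraph r → Set
AdmitsGoodOrder {r} H = ∃[ es ] (es ↭ edges H × GoodOrder r es)

-- For an r-set R and w ∈ R let ν(w) be the sign of σ(R ∖ {w}) relative to the
-- boundary orientation of R, i.e. σ(R ∖ {w}) times (−1)^#{v ∈ R : v > w}.  The
-- R-weight of R ∖ {u, v} vanishes iff ν(u) = ν(v), so R is an edge of G(σ) iff ν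
-- is constant on R.  Once w₀ ∈ R is fixed, this pins down each of the r − 1 coins
-- σ(R ∖ {w}), w ≠ w₀, so R is an edge with probability 2^(1−r), even conditionally
-- on any event that does not involve these coins.  In a good ordering e₁, …, e_m
-- each eᵢ meets the earlier edges in at most one (r − 1)-set; taking w₀ to be the
-- vertex of eᵢ outside it, the facets of eᵢ other than eᵢ ∖ {w₀} lie in no earlier
-- edge.  Peeling off e_m, …, e₁ (mapped by an injective φ) one at a time therefore
-- gives probability 2^((1−r)m) that φ is a homomorphism.  At most k²/n of the n^k
-- maps V(H) → [n] fail to be injective, which costs only O(1/n).

module Submission where

open import Defs
open import Data.Bool using (Bool; true; false; _∧_; _∨_; not; _xor_)
import Data.Bool.Properties as Boolₚ
open import Data.Nat as ℕ using (ℕ; zero; suc; _∸_; s≤s; z≤n)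
import Data.Nat.Properties as ℕₚ
open import Data.Integer as ℤ using (ℤ)
import Data.Integer.Properties as ℤₚ
open import Data.Rational as ℚ using (ℚ; ½; 0ℚ; 1ℚ)
import Data.Rational.Properties as ℚₚ
open import Data.Fin as Fin using (Fin; zero; suc)
import Data.Fin.Properties as Finₚ
open import Data.Fin.Subset using (Subset; ∣_∣; _∈_; _∉_; _⊆_; _∩_; _∪_; _─_; _-_; ⁅_⁆; ⊥)
open import Data.Fin.Subset.Properties
  using (_∈?_; _⊆?_; ⊆-antisym; drop-∷-⊆; p⊆q⇒∣p∣≤∣q∣; p⊂q⇒∣p∣<∣q∣; x∈⁅x⁆; x∈⁅y⁆⇒x≡y; x∉⁅y⁆⇒x≢y;
         x∈p∪q⁺; x∈p∪q⁻; x∈p∩q⁺; x∈p∩q⁻; p∩q⊆p; ∣p∩q∣≤∣p∣; ∉⊥; ∣⊥∣≡0; p─⊥≡p; x∈p∧x∉q⇒x∈p─q; x∈p∧x≢y⇒x∈p-y;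
         in⊆in; out⊆; drop-there; ∪-identityˡ; p─x─y≡p─y─x)
open import Data.Vec as Vec using (Vec; []; _∷_; here; there)
import Data.Vec.Properties as Vecₚ
open import Data.List as List using (List; []; _∷_; _++_; map; filter; length; reverse)
import Data.List.Properties as Listₚ
open import Data.List.Membership.Propositional using (find; lose) renaming (_∈_ to _∈ₗ_)
open import Data.List.Membership.Propositional.Properties using (∈-map⁺; ∈-map⁻; ∈-filter⁺; ∈-filter⁻; ∈-++⁺ˡ; ∈-++⁺ʳ)
open import Data.List.Relation.Unary.All as All using (All; []; _∷_)
import Data.List.Relation.Unary.All.Properties as Allₚ
open import Data.List.Relation.Unary.AllPairs as AllPairs using (AllPairs; []; _∷_)
import Data.List.Relation.Unary.AllPairs.Properties as AllPairsₚ
open import Data.List.Relation.Unary.Any as Any using (here; there)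
import Data.List.Relation.Unary.Any.Properties as Anyₚ
open import Data.List.Relation.Binary.Permutation.Propositional using (_↭_; prep; swap; ↭-refl; ↭-sym; ↭⇒↭ₛ)
open import Data.List.Relation.Binary.Permutation.Propositional.Properties using (∈-resp-↭; ↭-reverse; ↭-length)
import Data.List.Relation.Binary.Permutation.Setoid.Properties as Permutationₛₚ
open import Data.Product using (_×_; _,_; proj₁; proj₂; ∃-syntax)
open import Data.Sum using (inj₁; inj₂)
open import Data.Empty using (⊥-elim)
open import Function using (id; _∘_; case_of_; _⇔_; mk⇔; Equivalence)
open import Relation.Binary.PropositionalEquality
open import Relation.Nullary using (Dec; yes; no; ¬_; does)
open import Relation.Nullary.Decidable using (⌊_⌋; ¬?)
open import Relation.Unary using (Decidable)
open import Relation.Binary.Definitions using (tri<; tri≈; tri>)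

-- Lists and subsets of Fin n

module _ {A : Set} (p : A → Bool) where

  allB⁺ : ∀ xs → (∀ {x} → x ∈ₗ xs → p x ≡ true) → allB p xs ≡ true
  allB⁺ []       h = refl
  allB⁺ (x ∷ xs) h rewrite h (here refl) = allB⁺ xs (h ∘ there)

  allB⁻ : ∀ xs → allB p xs ≡ true → ∀ {x} → x ∈ₗ xs → p x ≡ true
  allB⁻ (y ∷ xs) h m with p y in py
  allB⁻ (y ∷ xs) h (here refl) | true = py
  allB⁻ (y ∷ xs) h (there m)   | true = allB⁻ xs h m
  allB⁻ (y ∷ xs) () _          | false

  allB-↭ : ∀ {xs ys} → xs ↭ ys → allB p xs ≡ allB p ys
  allB-↭ _↭_.refl          = refl
  allB-↭ (prep x xs↭ys)    = cong (p x ∧_) (allB-↭ xs↭ys)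
  allB-↭ (swap x y xs↭ys)  = trans (∧-swap (p x) (p y) _) (cong (λ b → p y ∧ (p x ∧ b)) (allB-↭ xs↭ys))
    where
    ∧-swap : ∀ a b c → a ∧ (b ∧ c) ≡ b ∧ (a ∧ c)
    ∧-swap a b c = trans (sym (Boolₚ.∧-assoc a b c))
                     (trans (cong (_∧ c) (Boolₚ.∧-comm a b)) (Boolₚ.∧-assoc b a c))
  allB-↭ (_↭_.trans p₁ p₂) = trans (allB-↭ p₁) (allB-↭ p₂)

allB-cong : ∀ {A : Set} {p q : A → Bool} xs → (∀ {x} → x ∈ₗ xs → p x ≡ q x) → allB p xs ≡ allB q xs
allB-cong []       h = refl
allB-cong (x ∷ xs) h = cong₂ _∧_ (h (here refl)) (allB-cong xs (h ∘ there))

AllPairs-map-∈ : ∀ {A : Set} {R S : A → A → Set} {xs} → (∀ {x y} → x ∈ₗ xs → y ∈ₗ xs → R x y → S x y) →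
                 AllPairs R xs → AllPairs S xs
AllPairs-map-∈ f []            = []
AllPairs-map-∈ f (Rx ∷ Rxs) = All.tabulate (λ y∈ → f (here refl) (there y∈) (All.lookup Rx y∈))
                            ∷ AllPairs-map-∈ (λ x∈ y∈ → f (there x∈) (there y∈)) Rxs

≟-true⇔≡ : ∀ {a b : Bool} → ⌊ a Boolₚ.≟ b ⌋ ≡ true ⇔ a ≡ b
≟-true⇔≡ {true}  {true}  = mk⇔ (λ _ → refl) (λ _ → refl)
≟-true⇔≡ {true}  {false} = mk⇔ (λ ()) (λ ())
≟-true⇔≡ {false} {true}  = mk⇔ (λ ()) (λ ())
≟-true⇔≡ {false} {false} = mk⇔ (λ _ → refl) (λ _ → refl)

≡xor⇔xor≡ : ∀ {a c} k → a ≡ c xor k ⇔ a xor k ≡ c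
≡xor⇔xor≡ {a} {c} k = mk⇔ (λ { refl → xor-cancelʳ c }) (λ { refl → sym (xor-cancelʳ a) })
  where
  xor-cancelʳ : ∀ b → (b xor k) xor k ≡ b
  xor-cancelʳ b = trans (Boolₚ.xor-assoc b k k) (trans (cong (b xor_) (Boolₚ.xor-same k)) (Boolₚ.xor-identityʳ b))

≡true-⇔⇒≡ : ∀ {a b : Bool} → (a ≡ true → b ≡ true) → (b ≡ true → a ≡ true) → a ≡ b
≡true-⇔⇒≡ {true}  {true}  f g = refl
≡true-⇔⇒≡ {true}  {false} f g = sym (f refl)
≡true-⇔⇒≡ {false} {true}  f g = g refl
≡true-⇔⇒≡ {false} {false} f g = refl

module _ {A : Set} where

  reverse-≡-++-∷ : ∀ xs pre (x : A) post → reverse xs ≡ pre ++ x ∷ post → xs ≡ reverse post ++ x ∷ reverse pre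
  reverse-≡-++-∷ xs pre x post eq = begin
      xs                               ≡⟨ sym (Listₚ.reverse-involutive xs) ⟩
      reverse (reverse xs)             ≡⟨ cong reverse eq ⟩
      reverse (pre ++ x ∷ post)        ≡⟨ Listₚ.reverse-++ pre (x ∷ post) ⟩
      reverse (x ∷ post) ++ reverse pre ≡⟨ cong (_++ reverse pre) (Listₚ.unfold-reverse x post) ⟩
      (reverse post ++ x ∷ []) ++ reverse pre ≡⟨ Listₚ.++-assoc (reverse post) (x ∷ []) (reverse pre) ⟩
      reverse post ++ x ∷ reverse pre  ∎
    where open ≡-Reasoning

  AllPairs-++-∷ : ∀ {R : A → A → Set} pre x post → AllPairs R (pre ++ x ∷ post) → ∀ {a} → a ∈ₗ pre → R a x
  AllPairs-++-∷ (y ∷ pre) x post (Ry ∷ _)   (here refl) = All.lookup Ry (∈-++⁺ʳ pre (here refl))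
  AllPairs-++-∷ (y ∷ pre) x post (_ ∷ Rpre) (there a∈)  = AllPairs-++-∷ pre x post Rpre a∈

  position-++-∷ : ∀ pre (x : A) post → ∃[ i ] (List.lookup (pre ++ x ∷ post) i ≡ x ×
                    ∀ {a} → a ∈ₗ pre → ∃[ j ] (j Fin.< i × List.lookup (pre ++ x ∷ post) j ≡ a))
  position-++-∷ []        x post = zero , refl , λ ()
  position-++-∷ (y ∷ pre) x post =
    let i , lookup-i , earlier = position-++-∷ pre x post
    in suc i , lookup-i , λ where
         (here refl) → zero , s≤s z≤n , refl
         (there a∈)  → let j , j<i , lookup-j = earlier a∈ in suc j , s≤s j<i , lookup-j

StrictlyIncreasing : ∀ {n} → List (Fin n) → Set
StrictlyIncreasing = AllPairs Fin._<_

increasing-≡ : ∀ {n} {xs ys : List (Fin n)} → StrictlyIncreasing xs → StrictlyIncreasing ys →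
               (∀ {z} → z ∈ₗ xs → z ∈ₗ ys) → (∀ {z} → z ∈ₗ ys → z ∈ₗ xs) → xs ≡ ys
increasing-≡ {xs = []}     {[]}     _ _ _ _ = refl
increasing-≡ {xs = []}     {y ∷ ys} _ _ _ g with () ← g (here refl)
increasing-≡ {xs = x ∷ xs} {[]}     _ _ f _ with () ← f (here refl)
increasing-≡ {xs = x ∷ xs} {y ∷ ys} (x< ∷ xs↑) (y< ∷ ys↑) f g =
  cong₂ _∷_ x≡y (increasing-≡ xs↑ ys↑ f′ g′)
  where
  x≡y : x ≡ y
  x≡y with f (here refl) | g (here refl)
  ... | here x≡y | _        = x≡y
  ... | there _  | here y≡x = sym y≡x
  ... | there x∈ | there y∈ = ⊥-elim (Finₚ.<-asym (All.lookup y< x∈) (All.lookup x< y∈))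
  f′ : ∀ {z} → z ∈ₗ xs → z ∈ₗ ys
  f′ z∈ with f (there z∈)
  ... | here refl = ⊥-elim (Finₚ.<-irrefl x≡y (All.lookup x< z∈))
  ... | there z∈′ = z∈′
  g′ : ∀ {z} → z ∈ₗ ys → z ∈ₗ xs
  g′ z∈ with g (there z∈)
  ... | here refl = ⊥-elim (Finₚ.<-irrefl (sym x≡y) (All.lookup y< z∈))
  ... | there z∈′ = z∈′

∈-elems⁺ : ∀ {n} {x : Fin n} (p : Subset n) → x ∈ p → x ∈ₗ elems p
∈-elems⁺ (true  ∷ p) here       = here refl
∈-elems⁺ (true  ∷ p) (there x∈) = there (∈-map⁺ suc (∈-elems⁺ p x∈))
∈-elems⁺ (false ∷ p) (there x∈) = ∈-map⁺ suc (∈-elems⁺ p x∈)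

∈-elems⁻ : ∀ {n} {x : Fin n} (p : Subset n) → x ∈ₗ elems p → x ∈ p
∈-elems⁻ (true ∷ p) (here refl) = here
∈-elems⁻ (true ∷ p) (there x∈) with ∈-map⁻ suc x∈
... | y , y∈ , refl = there (∈-elems⁻ p y∈)
∈-elems⁻ (false ∷ p) x∈ with ∈-map⁻ suc x∈
... | y , y∈ , refl = there (∈-elems⁻ p y∈)

elems-increasing : ∀ {n} (p : Subset n) → StrictlyIncreasing (elems p)
elems-increasing []          = []
elems-increasing (true  ∷ p) =
  Allₚ.map⁺ (All.universal (λ _ → s≤s z≤n) (elems p)) ∷ AllPairsₚ.map⁺ (AllPairs.map s≤s (elems-increasing p))
elems-increasing (false ∷ p) = AllPairsₚ.map⁺ (AllPairs.map s≤s (elems-increasing p))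

∣p∣≡length-elems : ∀ {n} (p : Subset n) → ∣ p ∣ ≡ length (elems p)
∣p∣≡length-elems []          = refl
∣p∣≡length-elems (true  ∷ p) = cong suc (trans (∣p∣≡length-elems p) (sym (Listₚ.length-map suc (elems p))))
∣p∣≡length-elems (false ∷ p) = trans (∣p∣≡length-elems p) (sym (Listₚ.length-map suc (elems p)))

x∈p─q⁻ : ∀ {n} {x : Fin n} (p q : Subset n) → x ∈ p ─ q → x ∈ p × x ∉ q
x∈p─q⁻ (true ∷ p) (false ∷ q) here = here , λ ()
x∈p─q⁻ (_ ∷ p) (true  ∷ q) (there x∈) = let x∈p , x∉q = x∈p─q⁻ p q x∈ in there x∈p , λ { (there x∈q) → x∉q x∈q }
x∈p─q⁻ (_ ∷ p) (false ∷ q) (there x∈) = let x∈p , x∉q = x∈p─q⁻ p q x∈ in there x∈p , λ { (there x∈q) → x∉q x∈q }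

x∈p-y⁻ : ∀ {n} {x y : Fin n} (p : Subset n) → x ∈ p - y → x ∈ p × x ≢ y
x∈p-y⁻ {y = y} p x∈ = let x∈p , x∉y = x∈p─q⁻ p ⁅ y ⁆ x∈ in x∈p , x∉⁅y⁆⇒x≢y x∉y

∣p∣≡1+∣p-x∣ : ∀ {n} {x : Fin n} (p : Subset n) → x ∈ p → ∣ p ∣ ≡ suc ∣ p - x ∣
∣p∣≡1+∣p-x∣ (true  ∷ p) here       = cong (suc ∘ ∣_∣) (sym (p─⊥≡p p))
∣p∣≡1+∣p-x∣ (true  ∷ p) (there x∈) = cong suc (∣p∣≡1+∣p-x∣ p x∈)
∣p∣≡1+∣p-x∣ (false ∷ p) (there x∈) = ∣p∣≡1+∣p-x∣ p x∈

∣p-x∣≡∣p∣∸1 : ∀ {n} {x : Fin n} (p : Subset n) → x ∈ p → ∣ p - x ∣ ≡ ∣ p ∣ ∸ 1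
∣p-x∣≡∣p∣∸1 p x∈p = cong (_∸ 1) (sym (∣p∣≡1+∣p-x∣ p x∈p))

p-x≡p-y⇒x≡y : ∀ {n} (p : Subset n) {x y : Fin n} → y ∈ p → p - x ≡ p - y → x ≡ y
p-x≡p-y⇒x≡y p {x} {y} y∈p eq with x Fin.≟ y
... | yes x≡y = x≡y
... | no x≢y  = ⊥-elim (proj₂ (x∈p-y⁻ p (subst (y ∈_) eq (x∈p∧x≢y⇒x∈p-y y∈p (x≢y ∘ sym)))) refl)

x∈p-y-z⁻ : ∀ {n} {x y z : Fin n} (p : Subset n) → x ∈ p - y - z → x ∈ p × x ≢ y × x ≢ z
x∈p-y-z⁻ p x∈ = let x∈p-y , x≢z = x∈p-y⁻ (p - _) x∈ ; x∈p , x≢y = x∈p-y⁻ p x∈p-y in x∈p , x≢y , x≢z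

x∈p∧x≢y,z⇒x∈p-y-z : ∀ {n} {x y z : Fin n} {p : Subset n} → x ∈ p → x ≢ y → x ≢ z → x ∈ p - y - z
x∈p∧x≢y,z⇒x∈p-y-z x∈p x≢y x≢z = x∈p∧x≢y⇒x∈p-y (x∈p∧x≢y⇒x∈p-y x∈p x≢y) x≢z

p-x-y∪⁅x⁆≡p-y : ∀ {n} {x y : Fin n} (p : Subset n) → x ∈ p → x ≢ y → (p - x - y) ∪ ⁅ x ⁆ ≡ p - y
p-x-y∪⁅x⁆≡p-y {x = x} {y} p x∈p x≢y = ⊆-antisym ⊆-p-y p-y-⊆
  where
  ⊆-p-y : (p - x - y) ∪ ⁅ x ⁆ ⊆ p - y
  ⊆-p-y z∈ with x∈p∪q⁻ (p - x - y) ⁅ x ⁆ z∈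
  ... | inj₁ z∈p-x-y = let z∈p , _ , z≢y = x∈p-y-z⁻ p z∈p-x-y in x∈p∧x≢y⇒x∈p-y z∈p z≢y
  ... | inj₂ z∈⁅x⁆ rewrite x∈⁅y⁆⇒x≡y x z∈⁅x⁆ = x∈p∧x≢y⇒x∈p-y x∈p x≢y
  p-y-⊆ : p - y ⊆ (p - x - y) ∪ ⁅ x ⁆
  p-y-⊆ {z} z∈ with x∈p-y⁻ p z∈ | z Fin.≟ x
  ... | _         , _   | yes refl = x∈p∪q⁺ (inj₂ (x∈⁅x⁆ x))
  ... | z∈p , z≢y | no z≢x   = x∈p∪q⁺ (inj₁ (x∈p∧x≢y,z⇒x∈p-y-z z∈p z≢x z≢y))

∣p-x-y∣≡∣p∣∸2 : ∀ {n} {x y : Fin n} (p : Subset n) → x ∈ p → y ∈ p → x ≢ y → ∣ p - x - y ∣ ≡ ∣ p ∣ ∸ 2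
∣p-x-y∣≡∣p∣∸2 p x∈p y∈p x≢y =
  cong (_∸ 2) (sym (trans (∣p∣≡1+∣p-x∣ p x∈p) (cong suc (∣p∣≡1+∣p-x∣ (p - _) (x∈p∧x≢y⇒x∈p-y y∈p (x≢y ∘ sym))))))

∣p∣≡∣q∣+∣p─q∣ : ∀ {n} (p q : Subset n) → q ⊆ p → ∣ p ∣ ≡ ∣ q ∣ ℕ.+ ∣ p ─ q ∣
∣p∣≡∣q∣+∣p─q∣ []          []          _   = refl
∣p∣≡∣q∣+∣p─q∣ (true  ∷ p) (true  ∷ q) q⊆p = cong suc (∣p∣≡∣q∣+∣p─q∣ p q (drop-∷-⊆ q⊆p))
∣p∣≡∣q∣+∣p─q∣ (true  ∷ p) (false ∷ q) q⊆p =
  trans (cong suc (∣p∣≡∣q∣+∣p─q∣ p q (drop-∷-⊆ q⊆p))) (sym (ℕₚ.+-suc ∣ q ∣ _))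
∣p∣≡∣q∣+∣p─q∣ (false ∷ p) (false ∷ q) q⊆p = ∣p∣≡∣q∣+∣p─q∣ p q (drop-∷-⊆ q⊆p)
∣p∣≡∣q∣+∣p─q∣ (false ∷ p) (true  ∷ q) q⊆p with () ← q⊆p here

⊈⇒∃∉ : ∀ {n} (p q : Subset n) → ¬ (p ⊆ q) → ∃[ x ] (x ∈ p × x ∉ q)
⊈⇒∃∉ []          []          p⊈q = ⊥-elim (p⊈q λ ())
⊈⇒∃∉ (true  ∷ p) (false ∷ q) p⊈q = zero , here , λ ()
⊈⇒∃∉ (true  ∷ p) (true  ∷ q) p⊈q =
  let x , x∈p , x∉q = ⊈⇒∃∉ p q (p⊈q ∘ in⊆in) in suc x , there x∈p , x∉q ∘ drop-there
⊈⇒∃∉ (false ∷ p) (b     ∷ q) p⊈q =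
  let x , x∈p , x∉q = ⊈⇒∃∉ p q (p⊈q ∘ out⊆) in suc x , there x∈p , x∉q ∘ drop-there

⊆∧∣≡∣⇒⊇ : ∀ {n} {p q : Subset n} → p ⊆ q → ∣ p ∣ ≡ ∣ q ∣ → q ⊆ p
⊆∧∣≡∣⇒⊇ {p = p} {q} p⊆q ∣p∣≡∣q∣ with q ⊆? p
... | yes q⊆p = q⊆p
... | no  q⊈p = ⊥-elim (ℕₚ.<-irrefl ∣p∣≡∣q∣ (p⊂q⇒∣p∣<∣q∣ (p⊆q , ⊈⇒∃∉ q p q⊈p)))

∈-allSubsets : ∀ {n} (p : Subset n) → p ∈ₗ allSubsets n
∈-allSubsets []                = here refl
∈-allSubsets {suc n} (true  ∷ p) = ∈-++⁺ˡ (∈-map⁺ (true ∷_) (∈-allSubsets p))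
∈-allSubsets {suc n} (false ∷ p) = ∈-++⁺ʳ (map (true ∷_) (allSubsets n)) (∈-map⁺ (false ∷_) (∈-allSubsets p))

∈-kSubsets⁺ : ∀ {n k} (p : Subset n) → ∣ p ∣ ≡ k → p ∈ₗ kSubsets n k
∈-kSubsets⁺ {n} {k} p ∣p∣≡k = ∈-filter⁺ (λ p → ∣ p ∣ ℕ.≟ k) (∈-allSubsets p) ∣p∣≡k

∈-kSubsets⁻ : ∀ {n k} {p : Subset n} → p ∈ₗ kSubsets n k → ∣ p ∣ ≡ k
∈-kSubsets⁻ {n} {k} p∈ = proj₂ (∈-filter⁻ (λ p → ∣ p ∣ ℕ.≟ k) {xs = allSubsets n} p∈)

module _ where
  open import Data.Nat using (_+_)
  open import Algebra.Properties.CommutativeSemigroup ℕₚ.+-commutativeSemigroup using (x∙yz≈y∙xz)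

  length-filter-++ : ∀ {A : Set} {P : A → Set} (P? : Decidable P) xs ys →
                     length (filter P? (xs ++ ys)) ≡ length (filter P? xs) + length (filter P? ys)
  length-filter-++ P? xs ys = trans (cong length (Listₚ.filter-++ P? xs ys)) (Listₚ.length-++ (filter P? xs))

  length-filter-map-suc : ∀ {n} {P : Fin (suc n) → Set} (P? : Decidable P) xs →
                          length (filter P? (map suc xs)) ≡ length (filter (P? ∘ suc) xs)
  length-filter-map-suc P? []       = refl
  length-filter-map-suc P? (x ∷ xs) with does (P? (suc x))
  ... | true  = cong suc (length-filter-map-suc P? xs)
  ... | false = length-filter-map-suc P? xs

  length-filter-elems-remove : ∀ {n} {P : Fin n → Set} (P? : Decidable P) (X : Subset n) {x} → x ∈ X →
    length (filter P? (elems X)) ≡ length (filter P? (x ∷ [])) + length (filter P? (elems (X - x)))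
  length-filter-elems-remove P? (true ∷ X) here =
    trans (length-filter-++ P? (zero ∷ []) (map suc (elems X)))
          (cong (λ Y → length (filter P? (zero ∷ [])) + length (filter P? (map suc (elems Y)))) (sym (p─⊥≡p X)))
  length-filter-elems-remove P? (true ∷ X) {suc x} (there x∈X) = begin
      length (filter P? (zero ∷ map suc (elems X)))
    ≡⟨ length-filter-++ P? (zero ∷ []) (map suc (elems X)) ⟩
      c₀ + length (filter P? (map suc (elems X)))
    ≡⟨ cong (c₀ +_) (trans (length-filter-map-suc P? (elems X)) (length-filter-elems-remove (P? ∘ suc) X {x} x∈X)) ⟩
      c₀ + (length (filter (P? ∘ suc) (x ∷ [])) + length (filter (P? ∘ suc) (elems (X - x))))
    ≡⟨ cong (λ k → c₀ + (k + length (filter (P? ∘ suc) (elems (X - x))))) (sym (length-filter-map-suc P? (x ∷ []))) ⟩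
      c₀ + (cₓ + length (filter (P? ∘ suc) (elems (X - x))))
    ≡⟨ x∙yz≈y∙xz c₀ cₓ _ ⟩
      cₓ + (c₀ + length (filter (P? ∘ suc) (elems (X - x))))
    ≡⟨ cong (λ k → cₓ + (c₀ + k)) (sym (length-filter-map-suc P? (elems (X - x)))) ⟩
      cₓ + (c₀ + length (filter P? (map suc (elems (X - x)))))
    ≡⟨ cong (cₓ +_) (sym (length-filter-++ P? (zero ∷ []) (map suc (elems (X - x))))) ⟩
      cₓ + length (filter P? (zero ∷ map suc (elems (X - x))))
    ∎
    where
    open ≡-Reasoning
    c₀ cₓ : ℕ
    c₀ = length (filter P? (zero ∷ []))
    cₓ = length (filter P? (suc x ∷ []))
  length-filter-elems-remove P? (false ∷ X) {suc x} (there x∈X) = begin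
      length (filter P? (map suc (elems X)))
    ≡⟨ trans (length-filter-map-suc P? (elems X)) (length-filter-elems-remove (P? ∘ suc) X {x} x∈X) ⟩
      length (filter (P? ∘ suc) (x ∷ [])) + length (filter (P? ∘ suc) (elems (X - x)))
    ≡⟨ cong (_+ length (filter (P? ∘ suc) (elems (X - x)))) (sym (length-filter-map-suc P? (x ∷ []))) ⟩
      length (filter P? (suc x ∷ [])) + length (filter (P? ∘ suc) (elems (X - x)))
    ≡⟨ cong (length (filter P? (suc x ∷ [])) +_) (sym (length-filter-map-suc P? (elems (X - x)))) ⟩
      length (filter P? (suc x ∷ [])) + length (filter P? (map suc (elems (X - x))))
    ∎
    where open ≡-Reasoning

-- Averages over independent fair coins

module _ {n : ℕ} where

  update-≡ : ∀ (σ : Tournament n) T b {S} → S ≡ T → update σ T b S ≡ b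
  update-≡ σ T b {S} S≡T with Vecₚ.≡-dec Boolₚ._≟_ S T
  ... | yes _   = refl
  ... | no S≢T = ⊥-elim (S≢T S≡T)

  update-≢ : ∀ (σ : Tournament n) T b S → S ≢ T → update σ T b S ≡ σ S
  update-≢ σ T b S S≢T with Vecₚ.≡-dec Boolₚ._≟_ S T
  ... | yes S≡T = ⊥-elim (S≢T S≡T)
  ... | no _    = refl

  update-cong : ∀ {σ σ′ : Tournament n} T b → (∀ S → σ S ≡ σ′ S) → ∀ S → update σ T b S ≡ update σ′ T b S
  update-cong T b σ≗σ′ S with Vecₚ.≡-dec Boolₚ._≟_ S T
  ... | yes _ = refl
  ... | no _  = σ≗σ′ S

  update-comm : ∀ (σ : Tournament n) T T′ b b′ → T ≢ T′ → ∀ S →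
                update (update σ T b) T′ b′ S ≡ update (update σ T′ b′) T b S
  update-comm σ T T′ b b′ T≢T′ S = by-cases (Vecₚ.≡-dec Boolₚ._≟_ S T′) (Vecₚ.≡-dec Boolₚ._≟_ S T)
    where
    by-cases : Dec (S ≡ T′) → Dec (S ≡ T) → update (update σ T b) T′ b′ S ≡ update (update σ T′ b′) T b S
    by-cases (yes S≡T′) _ =
      trans (update-≡ _ T′ b′ S≡T′)
            (sym (trans (update-≢ _ T b S (λ S≡T → T≢T′ (trans (sym S≡T) S≡T′))) (update-≡ σ T′ b′ S≡T′)))
    by-cases (no S≢T′) (yes S≡T) =
      trans (update-≢ _ T′ b′ S S≢T′) (trans (update-≡ σ T b S≡T) (sym (update-≡ _ T b S≡T)))
    by-cases (no S≢T′) (no S≢T) =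
      trans (update-≢ _ T′ b′ S S≢T′)
            (trans (update-≢ σ T b S S≢T) (sym (trans (update-≢ _ T b S S≢T) (update-≢ σ T′ b′ S S≢T′))))

  -- Tournaments are functions and update only produces pointwise equal ones,
  -- so observables of a tournament must be shown to respect pointwise equality.
  Extensional : {A : Set} → (Tournament n → A) → Set
  Extensional f = ∀ σ σ′ → (∀ S → σ S ≡ σ′ S) → f σ ≡ f σ′

  IndependentOf : {A : Set} → Subset n → (Tournament n → A) → Set
  IndependentOf T f = ∀ σ b → f (update σ T b) ≡ f σ

module _ where
  open import Data.Rational using (_+_; _*_; _≤_)
  open import Data.Rational.Solver using (module +-*-Solver)
  open +-*-Solver

  𝟙 : Bool → ℚ
  𝟙 true  = 1ℚ
  𝟙 false = 0ℚ

  Pr : ∀ {n} → List (Subset n) → (Tournament n → Bool) → ℚ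
  Pr L P = avgOver L (𝟙 ∘ P)

  sumℚ : List ℚ → ℚ
  sumℚ = List.foldr _+_ 0ℚ

  halfPow-+ : ∀ a b → halfPow a * halfPow b ≡ halfPow (a ℕ.+ b)
  halfPow-+ zero    b = ℚₚ.*-identityˡ (halfPow b)
  halfPow-+ (suc a) b = trans (ℚₚ.*-assoc ½ (halfPow a) (halfPow b)) (cong (½ *_) (halfPow-+ a b))

  module _ {n : ℕ} where

    avgOver-cong : ∀ L {f g : Tournament n → ℚ} → (∀ σ → f σ ≡ g σ) → avgOver L f ≡ avgOver L g
    avgOver-cong []      f≗g = f≗g _
    avgOver-cong (T ∷ L) f≗g =
      cong₂ (λ a b → ½ * (a + b)) (avgOver-cong L (f≗g ∘ _)) (avgOver-cong L (f≗g ∘ _))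

    avgOver-const : ∀ L c → avgOver {n} L (λ _ → c) ≡ c
    avgOver-const []      c = refl
    avgOver-const (T ∷ L) c rewrite avgOver-const L c =
      solve 1 (λ c → con ½ :* (c :+ c) := c) refl c

    avgOver-+ : ∀ L (f g : Tournament n → ℚ) → avgOver L (λ σ → f σ + g σ) ≡ avgOver L f + avgOver L g
    avgOver-+ []      f g = refl
    avgOver-+ (T ∷ L) f g
      rewrite avgOver-+ L (λ σ → f (update σ T true))  (λ σ → g (update σ T true))
            | avgOver-+ L (λ σ → f (update σ T false)) (λ σ → g (update σ T false)) =
      solve 4 (λ a b c d → con ½ :* ((a :+ b) :+ (c :+ d)) := con ½ :* (a :+ c) :+ con ½ :* (b :+ d)) refl
        (avgOver L (λ σ → f (update σ T true))) (avgOver L (λ σ → g (update σ T true)))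
        (avgOver L (λ σ → f (update σ T false))) (avgOver L (λ σ → g (update σ T false)))

    avgOver-*ˡ : ∀ L q (f : Tournament n → ℚ) → avgOver L (λ σ → q * f σ) ≡ q * avgOver L f
    avgOver-*ˡ []      q f = refl
    avgOver-*ˡ (T ∷ L) q f
      rewrite avgOver-*ˡ L q (λ σ → f (update σ T true))
            | avgOver-*ˡ L q (λ σ → f (update σ T false)) =
      solve 3 (λ q a b → con ½ :* (q :* a :+ q :* b) := q :* (con ½ :* (a :+ b))) refl
        q (avgOver L (λ σ → f (update σ T true))) (avgOver L (λ σ → f (update σ T false)))

    avgOver-*ʳ : ∀ L q (f : Tournament n → ℚ) → avgOver L (λ σ → f σ * q) ≡ avgOver L f * q
    avgOver-*ʳ L q f = trans (avgOver-cong L (λ σ → ℚₚ.*-comm (f σ) q))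
                             (trans (avgOver-*ˡ L q f) (ℚₚ.*-comm q (avgOver L f)))

    avgOver-mono : ∀ L {f g : Tournament n → ℚ} → (∀ σ → f σ ≤ g σ) → avgOver L f ≤ avgOver L g
    avgOver-mono []      f≤g = f≤g _
    avgOver-mono (T ∷ L) f≤g =
      ℚₚ.*-monoˡ-≤-nonNeg ½ (ℚₚ.+-mono-≤ (avgOver-mono L (f≤g ∘ _)) (avgOver-mono L (f≤g ∘ _)))

    avgOver-sum : ∀ {A : Set} L (F : A → Tournament n → ℚ) xs →
                  avgOver L (λ σ → sumℚ (map (λ x → F x σ) xs)) ≡ sumℚ (map (λ x → avgOver L (F x)) xs)
    avgOver-sum L F []       = avgOver-const L 0ℚ
    avgOver-sum L F (x ∷ xs) =
      trans (avgOver-+ L (F x) _) (cong (avgOver L (F x) +_) (avgOver-sum L F xs))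

    Pr-bounded : ∀ L (P : Tournament n → Bool) → 0ℚ ≤ Pr L P × Pr L P ≤ 1ℚ
    Pr-bounded L P =
      ℚₚ.≤-trans (ℚₚ.≤-reflexive (sym (avgOver-const L 0ℚ))) (avgOver-mono L (0≤𝟙 ∘ P)) ,
      ℚₚ.≤-trans (avgOver-mono L (𝟙≤1 ∘ P)) (ℚₚ.≤-reflexive (avgOver-const L 1ℚ))
      where
      0≤𝟙 : ∀ b → 0ℚ ≤ 𝟙 b
      0≤𝟙 true  = ℚₚ.nonNegative⁻¹ 1ℚ
      0≤𝟙 false = ℚₚ.≤-refl
      𝟙≤1 : ∀ b → 𝟙 b ≤ 1ℚ
      𝟙≤1 true  = ℚₚ.≤-refl
      𝟙≤1 false = ℚₚ.nonNegative⁻¹ 1ℚ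

    Extensional-update : ∀ {A : Set} {f : Tournament n → A} T b → Extensional f → Extensional (λ σ → f (update σ T b))
    Extensional-update T b ext σ σ′ σ≗σ′ = ext _ _ (update-cong T b σ≗σ′)

    IndependentOf-update : ∀ {A : Set} {f : Tournament n → A} {T} T′ b → T ≢ T′ → Extensional f →
                           IndependentOf T f → IndependentOf T (λ σ → f (update σ T′ b))
    IndependentOf-update {T = T} T′ b′ T≢T′ ext indep σ b =
      trans (ext _ _ (update-comm σ T T′ b b′ T≢T′)) (indep (update σ T′ b′) b)

    Guess : Set
    Guess = Subset n × (Tournament n → Bool)

    guessed : Tournament n → Guess → Bool
    guessed σ (T , g) = ⌊ σ T Boolₚ.≟ g σ ⌋

    -- Of the two values of the coin T exactly one agrees with g, and neither P nor g sees the coin.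
    Pr-∧-guessed-head : ∀ L T (P g : Tournament n → Bool) → IndependentOf T P → IndependentOf T g →
                        Pr (T ∷ L) (λ σ → P σ ∧ guessed σ (T , g)) ≡ ½ * Pr (T ∷ L) P
    Pr-∧-guessed-head L T P g indepP indepg = begin
        ½ * (avgOver L (λ σ → 𝟙 (P (update σ T true) ∧ guessed (update σ T true) (T , g)))
           + avgOver L (λ σ → 𝟙 (P (update σ T false) ∧ guessed (update σ T false) (T , g))))
      ≡⟨ cong₂ (λ a b → ½ * (a + b)) (avgOver-cong L (coin-fixed true)) (avgOver-cong L (coin-fixed false)) ⟩
        ½ * (avgOver L (λ σ → 𝟙 (P σ ∧ ⌊ true Boolₚ.≟ g σ ⌋)) + avgOver L (λ σ → 𝟙 (P σ ∧ ⌊ false Boolₚ.≟ g σ ⌋)))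
      ≡⟨ cong (½ *_) (trans (sym (avgOver-+ L _ _)) (avgOver-cong L (λ σ → 𝟙-split (P σ) (g σ)))) ⟩
        ½ * Pr L P
      ≡⟨ cong (½ *_) (sym (trans (cong₂ (λ a b → ½ * (a + b)) (avgOver-cong L (cong 𝟙 ∘ λ σ → indepP σ true))
                                                               (avgOver-cong L (cong 𝟙 ∘ λ σ → indepP σ false)))
                                 (solve 1 (λ a → con ½ :* (a :+ a) := a) refl (Pr L P)))) ⟩
        ½ * Pr (T ∷ L) P
      ∎
      where
      open ≡-Reasoning
      coin-fixed : ∀ b σ → 𝟙 (P (update σ T b) ∧ guessed (update σ T b) (T , g)) ≡ 𝟙 (P σ ∧ ⌊ b Boolₚ.≟ g σ ⌋)
      coin-fixed b σ rewrite indepP σ b | update-≡ σ T b refl | indepg σ b = refl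
      𝟙-split : ∀ p d → 𝟙 (p ∧ ⌊ true Boolₚ.≟ d ⌋) + 𝟙 (p ∧ ⌊ false Boolₚ.≟ d ⌋) ≡ 𝟙 p
      𝟙-split true  true  = refl
      𝟙-split true  false = refl
      𝟙-split false true  = refl
      𝟙-split false false = refl

    Pr-∧-guessed : ∀ L {T} → T ∈ₗ L → (P g : Tournament n → Bool) →
                   Extensional P → IndependentOf T P → Extensional g → IndependentOf T g →
                   Pr L (λ σ → P σ ∧ guessed σ (T , g)) ≡ ½ * Pr L P
    Pr-∧-guessed (T′ ∷ L) {T} T∈ P g extP indepP extg indepg with Vecₚ.≡-dec Boolₚ._≟_ T′ T
    ... | yes refl = Pr-∧-guessed-head L T P g indepP indepg
    ... | no T′≢T with T∈
    ...   | here T≡T′ = ⊥-elim (T′≢T (sym T≡T′))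
    ...   | there T∈L = begin
        ½ * (avgOver L (λ σ → 𝟙 (P⟨ true ⟩ σ ∧ guessed (update σ T′ true) (T , g)))
           + avgOver L (λ σ → 𝟙 (P⟨ false ⟩ σ ∧ guessed (update σ T′ false) (T , g))))
      ≡⟨ cong₂ (λ a b → ½ * (a + b)) (avgOver-cong L (coin-T-untouched true)) (avgOver-cong L (coin-T-untouched false)) ⟩
        ½ * (Pr L (λ σ → P⟨ true ⟩ σ ∧ guessed σ (T , g⟨ true ⟩)) + Pr L (λ σ → P⟨ false ⟩ σ ∧ guessed σ (T , g⟨ false ⟩)))
      ≡⟨ cong₂ (λ a b → ½ * (a + b)) (induction true) (induction false) ⟩
        ½ * (½ * Pr L P⟨ true ⟩ + ½ * Pr L P⟨ false ⟩)
      ≡⟨ solve 3 (λ h a b → h :* (h :* a :+ h :* b) := h :* (h :* (a :+ b))) refl ½ (Pr L P⟨ true ⟩) (Pr L P⟨ false ⟩) ⟩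
        ½ * Pr (T′ ∷ L) P
      ∎
      where
      open ≡-Reasoning
      T≢T′ : T ≢ T′
      T≢T′ = T′≢T ∘ sym
      P⟨_⟩ g⟨_⟩ : Bool → Tournament n → Bool
      P⟨ b ⟩ σ = P (update σ T′ b)
      g⟨ b ⟩ σ = g (update σ T′ b)
      coin-T-untouched : ∀ b σ → 𝟙 (P⟨ b ⟩ σ ∧ guessed (update σ T′ b) (T , g)) ≡ 𝟙 (P⟨ b ⟩ σ ∧ guessed σ (T , g⟨ b ⟩))
      coin-T-untouched b σ = cong (λ c → 𝟙 (P⟨ b ⟩ σ ∧ ⌊ c Boolₚ.≟ g⟨ b ⟩ σ ⌋)) (update-≢ σ T′ b T T≢T′)
      induction : ∀ b → Pr L (λ σ → P⟨ b ⟩ σ ∧ guessed σ (T , g⟨ b ⟩)) ≡ ½ * Pr L P⟨ b ⟩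
      induction b = Pr-∧-guessed L T∈L P⟨ b ⟩ g⟨ b ⟩
        (Extensional-update T′ b extP) (IndependentOf-update T′ b T≢T′ extP indepP)
        (Extensional-update T′ b extg) (IndependentOf-update T′ b T≢T′ extg indepg)

    private
      allGuessed-extensional : ∀ gs → All (Extensional ∘ proj₂) gs → Extensional (λ σ → allB (guessed σ) gs)
      allGuessed-extensional []             _              σ σ′ σ≗σ′ = refl
      allGuessed-extensional ((T , g) ∷ gs) (extg ∷ extgs) σ σ′ σ≗σ′ =
        cong₂ _∧_ (cong₂ (λ c d → ⌊ c Boolₚ.≟ d ⌋) (σ≗σ′ T) (extg σ σ′ σ≗σ′)) (allGuessed-extensional gs extgs σ σ′ σ≗σ′)

      allGuessed-independent : ∀ T gs → All (λ (T′ , _) → T ≢ T′) gs → All (IndependentOf T ∘ proj₂) gs →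
                               IndependentOf T (λ σ → allB (guessed σ) gs)
      allGuessed-independent T []             _              _                σ b = refl
      allGuessed-independent T ((T′ , g) ∷ gs) (T≢T′ ∷ T≢Ts) (indepg ∷ indepgs) σ b =
        cong₂ _∧_ (cong₂ (λ c d → ⌊ c Boolₚ.≟ d ⌋) (update-≢ σ T b T′ (T≢T′ ∘ sym)) (indepg σ b))
                  (allGuessed-independent T gs T≢Ts indepgs σ b)

    Pr-∧-allGuessed : ∀ L (P : Tournament n → Bool) (gs : List Guess) →
                     All (λ (T , _) → T ∈ₗ L) gs → AllPairs (λ (T , _) (T′ , _) → T ≢ T′) gs →
                     Extensional P → All (λ (T , _) → IndependentOf T P) gs →
                     All (Extensional ∘ proj₂) gs →
                     (∀ {h h′} → h ∈ₗ gs → h′ ∈ₗ gs → IndependentOf (proj₁ h′) (proj₂ h)) →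
                     Pr L (λ σ → P σ ∧ allB (guessed σ) gs) ≡ halfPow (length gs) * Pr L P
    Pr-∧-allGuessed L P [] _ _ _ _ _ _ =
      trans (avgOver-cong L (cong 𝟙 ∘ Boolₚ.∧-identityʳ ∘ P)) (sym (ℚₚ.*-identityˡ (Pr L P)))
    Pr-∧-allGuessed L P ((T , g) ∷ gs) (T∈L ∷ Ts∈L) (T≢Ts ∷ distinct) extP (indepP ∷ indepPs) (extg ∷ extgs) indep = begin
        Pr L (λ σ → P σ ∧ (guessed σ (T , g) ∧ rest σ))
      ≡⟨ avgOver-cong L (λ σ → cong 𝟙 (∧-rotate (P σ) _ (rest σ))) ⟩
        Pr L (λ σ → (P σ ∧ rest σ) ∧ guessed σ (T , g))
      ≡⟨ Pr-∧-guessed L T∈L (λ σ → P σ ∧ rest σ) g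
           (λ σ σ′ σ≗σ′ → cong₂ _∧_ (extP σ σ′ σ≗σ′) (allGuessed-extensional gs extgs σ σ′ σ≗σ′))
           (λ σ b → cong₂ _∧_ (indepP σ b)
                     (allGuessed-independent T gs T≢Ts (All.tabulate (λ h∈ → indep (there h∈) (here refl))) σ b))
           extg (indep (here refl) (here refl)) ⟩
        ½ * Pr L (λ σ → P σ ∧ rest σ)
      ≡⟨ cong (½ *_) (Pr-∧-allGuessed L P gs Ts∈L distinct extP indepPs extgs (λ h∈ h′∈ → indep (there h∈) (there h′∈))) ⟩
        ½ * (halfPow (length gs) * Pr L P)
      ≡⟨ sym (ℚₚ.*-assoc ½ (halfPow (length gs)) (Pr L P)) ⟩
        halfPow (length ((T , g) ∷ gs)) * Pr L P
      ∎
      where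
      open ≡-Reasoning
      rest : Tournament n → Bool
      rest σ = allB (guessed σ) gs
      ∧-rotate : ∀ a b c → a ∧ (b ∧ c) ≡ (a ∧ c) ∧ b
      ∧-rotate a b c = trans (cong (a ∧_) (Boolₚ.∧-comm b c)) (sym (Boolₚ.∧-assoc a c b))

-- Which r-sets are edges of G(σ)

module _ where
  open import Data.Nat using (_+_)

  #above : ∀ {n} → Subset n → Fin n → ℕ
  #above X w = length (filter (w Fin.<?_) (elems X))

  inversions-snoc : ∀ {n} (xs : List (Fin n)) w →
                    inversions (xs ++ w ∷ []) ≡ length (filter (w Fin.<?_) xs) + inversions xs
  inversions-snoc []       w = refl
  inversions-snoc (x ∷ xs) w = begin
      length (filter (Fin._<? x) (xs ++ w ∷ [])) + inversions (xs ++ w ∷ [])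
    ≡⟨ cong₂ _+_ (length-filter-++ (Fin._<? x) xs (w ∷ [])) (inversions-snoc xs w) ⟩
      (a + [w<x]) + (b + i)
    ≡⟨ cong (λ k → (a + k) + (b + i)) [w<x]≡[w<x]′ ⟩
      (a + [w<x]′) + (b + i)
    ≡⟨ solve 4 (λ a c b i → (a :+ c) :+ (b :+ i) := (c :+ b) :+ (a :+ i)) refl a [w<x]′ b i ⟩
      ([w<x]′ + b) + (a + i)
    ≡⟨ cong (_+ (a + i)) (sym (length-filter-++ (w Fin.<?_) (x ∷ []) xs)) ⟩
      length (filter (w Fin.<?_) (x ∷ xs)) + (a + i)
    ∎
    where
    open ≡-Reasoning
    open import Data.Nat.Solver using (module +-*-Solver)
    open +-*-Solver
    a = length (filter (Fin._<? x) xs)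
    b = length (filter (w Fin.<?_) xs)
    i = inversions xs
    [w<x] = length (filter (Fin._<? x) (w ∷ []))
    [w<x]′ = length (filter (w Fin.<?_) (x ∷ []))
    [w<x]≡[w<x]′ : [w<x] ≡ [w<x]′
    [w<x]≡[w<x]′ with Fin.toℕ w ℕ.<ᵇ Fin.toℕ x
    ... | true  = refl
    ... | false = refl

  inversions-increasing : ∀ {n} {xs : List (Fin n)} → StrictlyIncreasing xs → inversions xs ≡ 0
  inversions-increasing []               = refl
  inversions-increasing {xs = x ∷ xs} (x< ∷ xs↑) =
    trans (cong (λ ys → length ys + inversions xs) (Listₚ.filter-none (Fin._<? x) (All.map Finₚ.<-asym x<)))
          (inversions-increasing xs↑)

  odd : ℕ → Bool
  odd zero    = false
  odd (suc k) = not (odd k)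

  sgn*parity : ∀ a k → sgn a ℤ.* parity k ≡ sgn (a xor odd k)
  sgn*parity true  zero    = refl
  sgn*parity false zero    = refl
  sgn*parity a     (suc k) = begin
      sgn a ℤ.* ℤ.- parity k
    ≡⟨ sym (ℤₚ.neg-distribʳ-* (sgn a) (parity k)) ⟩
      ℤ.- (sgn a ℤ.* parity k)
    ≡⟨ cong ℤ.-_ (sgn*parity a k) ⟩
      ℤ.- sgn (a xor odd k)
    ≡⟨ -sgn (a xor odd k) ⟩
      sgn (not (a xor odd k))
    ≡⟨ cong sgn (Boolₚ.not-distribʳ-xor a (odd k)) ⟩
      sgn (a xor not (odd k))
    ∎
    where
    open ≡-Reasoning
    -sgn : ∀ b → ℤ.- sgn b ≡ sgn (not b)
    -sgn true  = refl
    -sgn false = refl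

  tSign≡ : ∀ {n} (σ : Tournament n) S w → tSign σ S w ≡ sgn (σ (S ∪ ⁅ w ⁆) xor odd (#above S w))
  tSign≡ σ S w = begin
      sgn (σ (S ∪ ⁅ w ⁆)) ℤ.* parity (inversions (elems S ++ w ∷ []))
    ≡⟨ cong (λ k → sgn (σ (S ∪ ⁅ w ⁆)) ℤ.* parity k)
         (trans (inversions-snoc (elems S) w)
                (trans (cong (#above S w +_) (inversions-increasing (elems-increasing S))) (ℕₚ.+-identityʳ _))) ⟩
      sgn (σ (S ∪ ⁅ w ⁆)) ℤ.* parity (#above S w)
    ≡⟨ sgn*parity (σ (S ∪ ⁅ w ⁆)) (#above S w) ⟩
      sgn (σ (S ∪ ⁅ w ⁆) xor odd (#above S w))
    ∎
    where open ≡-Reasoning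

  -- ν(w) of the proof sketch: the sign of σ(R ∖ {w}) relative to the boundary orientation of R.
  facetSign : ∀ {n} → Tournament n → Subset n → Fin n → Bool
  facetSign σ R w = σ (R - w) xor odd (#above R w)

  weight-zero⇔ : ∀ a b x y → sgn (a xor x) ℤ.+ (sgn (b xor y) ℤ.+ ℤ.+ 0) ≡ ℤ.+ 0 ⇔ b xor not x ≡ a xor y
  weight-zero⇔ true  true  true  true  = mk⇔ (λ ()) (λ ())
  weight-zero⇔ true  true  true  false = mk⇔ (λ _ → refl) (λ _ → refl)
  weight-zero⇔ true  true  false true  = mk⇔ (λ _ → refl) (λ _ → refl)
  weight-zero⇔ true  true  false false = mk⇔ (λ ()) (λ ())
  weight-zero⇔ true  false true  true  = mk⇔ (λ _ → refl) (λ _ → refl)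
  weight-zero⇔ true  false true  false = mk⇔ (λ ()) (λ ())
  weight-zero⇔ true  false false true  = mk⇔ (λ ()) (λ ())
  weight-zero⇔ true  false false false = mk⇔ (λ _ → refl) (λ _ → refl)
  weight-zero⇔ false true  true  true  = mk⇔ (λ _ → refl) (λ _ → refl)
  weight-zero⇔ false true  true  false = mk⇔ (λ ()) (λ ())
  weight-zero⇔ false true  false true  = mk⇔ (λ ()) (λ ())
  weight-zero⇔ false true  false false = mk⇔ (λ _ → refl) (λ _ → refl)
  weight-zero⇔ false false true  true  = mk⇔ (λ ()) (λ ())
  weight-zero⇔ false false true  false = mk⇔ (λ _ → refl) (λ _ → refl)
  weight-zero⇔ false false false true  = mk⇔ (λ _ → refl) (λ _ → refl)
  weight-zero⇔ false false false false = mk⇔ (λ ()) (λ ())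

  module _ {n} (σ : Tournament n) (R : Subset n) {u v : Fin n} (u∈R : u ∈ R) (v∈R : v ∈ R) (u<v : u Fin.< v) where

    private
      S : Subset n
      S = R - u - v

      u≢v : u ≢ v
      u≢v = Finₚ.<⇒≢ u<v

      v∈R-u : v ∈ R - u
      v∈R-u = x∈p∧x≢y⇒x∈p-y v∈R (u≢v ∘ sym)

      outside-S : filter (λ x → ¬? (x ∈? S)) (elems R) ≡ u ∷ v ∷ []
      outside-S = increasing-≡ (AllPairsₚ.filter⁺ (λ x → ¬? (x ∈? S)) (elems-increasing R)) ((u<v ∷ []) ∷ [] ∷ [])
                               to from
        where
        to : ∀ {z} → z ∈ₗ filter (λ x → ¬? (x ∈? S)) (elems R) → z ∈ₗ u ∷ v ∷ []
        to {z} z∈ with ∈-filter⁻ (λ x → ¬? (x ∈? S)) {xs = elems R} z∈ | z Fin.≟ u | z Fin.≟ v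
        ... | _ , _ | yes refl | _        = here refl
        ... | _ , _ | no _     | yes refl = there (here refl)
        ... | z∈R , z∉S | no z≢u | no z≢v = ⊥-elim (z∉S (x∈p∧x≢y,z⇒x∈p-y-z (∈-elems⁻ R z∈R) z≢u z≢v))
        from : ∀ {z} → z ∈ₗ u ∷ v ∷ [] → z ∈ₗ filter (λ x → ¬? (x ∈? S)) (elems R)
        from (here refl) =
          ∈-filter⁺ (λ x → ¬? (x ∈? S)) (∈-elems⁺ R u∈R) (λ u∈S → proj₁ (proj₂ (x∈p-y-z⁻ R u∈S)) refl)
        from (there (here refl)) =
          ∈-filter⁺ (λ x → ¬? (x ∈? S)) (∈-elems⁺ R v∈R) (λ v∈S → proj₂ (proj₂ (x∈p-y-z⁻ R v∈S)) refl)

      S∪⁅v⁆≡R-u : S ∪ ⁅ v ⁆ ≡ R - u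
      S∪⁅v⁆≡R-u = trans (cong (_∪ ⁅ v ⁆) (p─x─y≡p─y─x R u v)) (p-x-y∪⁅x⁆≡p-y R v∈R (u≢v ∘ sym))

      #above-u : #above R u ≡ suc (#above S u)
      #above-u = begin
          #above R u
        ≡⟨ length-filter-elems-remove (u Fin.<?_) R u∈R ⟩
          length (filter (u Fin.<?_) (u ∷ [])) + #above (R - u) u
        ≡⟨ cong₂ _+_ (cong length (Listₚ.filter-reject (u Fin.<?_) (Finₚ.<-irrefl refl)))
                     (length-filter-elems-remove (u Fin.<?_) (R - u) v∈R-u) ⟩
          length (filter (u Fin.<?_) (v ∷ [])) + #above S u
        ≡⟨ cong (λ xs → length xs + #above S u) (Listₚ.filter-accept (u Fin.<?_) u<v) ⟩
          suc (#above S u)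
        ∎
        where open ≡-Reasoning

      #above-v : #above R v ≡ #above S v
      #above-v = begin
          #above R v
        ≡⟨ length-filter-elems-remove (v Fin.<?_) R u∈R ⟩
          length (filter (v Fin.<?_) (u ∷ [])) + #above (R - u) v
        ≡⟨ cong₂ _+_ (cong length (Listₚ.filter-reject (v Fin.<?_) (Finₚ.<-asym u<v)))
                     (length-filter-elems-remove (v Fin.<?_) (R - u) v∈R-u) ⟩
          length (filter (v Fin.<?_) (v ∷ [])) + #above S v
        ≡⟨ cong (λ xs → length xs + #above S v) (Listₚ.filter-reject (v Fin.<?_) (Finₚ.<-irrefl refl)) ⟩
          #above S v
        ∎
        where open ≡-Reasoning

      rWeight≡ : rWeight σ R S ≡ sgn (σ (R - v) xor odd (#above S u)) ℤ.+ (sgn (σ (R - u) xor odd (#above S v)) ℤ.+ ℤ.+ 0)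
      rWeight≡ = begin
          List.foldr ℤ._+_ (ℤ.+ 0) (map (tSign σ S) (filter (λ x → ¬? (x ∈? S)) (elems R)))
        ≡⟨ cong (λ xs → List.foldr ℤ._+_ (ℤ.+ 0) (map (tSign σ S) xs)) outside-S ⟩
          tSign σ S u ℤ.+ (tSign σ S v ℤ.+ ℤ.+ 0)
        ≡⟨ cong₂ (λ a b → a ℤ.+ (b ℤ.+ ℤ.+ 0))
             (trans (tSign≡ σ S u) (cong (λ T → sgn (σ T xor odd (#above S u))) (p-x-y∪⁅x⁆≡p-y R u∈R u≢v)))
             (trans (tSign≡ σ S v) (cong (λ T → sgn (σ T xor odd (#above S v))) S∪⁅v⁆≡R-u)) ⟩
          sgn (σ (R - v) xor odd (#above S u)) ℤ.+ (sgn (σ (R - u) xor odd (#above S v)) ℤ.+ ℤ.+ 0)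
        ∎
        where open ≡-Reasoning

    rWeight-zero⇔facetSign≡ : rWeight σ R (R - u - v) ≡ ℤ.+ 0 ⇔ facetSign σ R u ≡ facetSign σ R v
    rWeight-zero⇔facetSign≡ = mk⇔
      (λ w≡0 → trans (cong (λ k → σ (R - u) xor odd k) #above-u)
                 (trans (Equivalence.to W (trans (sym rWeight≡) w≡0)) (cong (λ k → σ (R - v) xor odd k) (sym #above-v))))
      (λ u≡v → trans rWeight≡ (Equivalence.from W
                 (trans (cong (λ k → σ (R - u) xor odd k) (sym #above-u))
                        (trans u≡v (cong (λ k → σ (R - v) xor odd k) #above-v)))))
      where
      W = weight-zero⇔ (σ (R - v)) (σ (R - u)) (odd (#above S u)) (odd (#above S v))

module _ {n : ℕ} where
  open import Data.Nat using (_+_; _≤_)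

  private
    weightCondition : Tournament n → Subset n → Subset n → Bool
    weightCondition σ R S = not ⌊ S ⊆? R ⌋ ∨ ⌊ rWeight σ R S ℤ.≟ ℤ.+ 0 ⌋

    isEdgeG-unfold : ∀ r σ (R : Subset n) → ∣ R ∣ ≡ r → isEdgeG r σ R ≡ allB (weightCondition σ R) (kSubsets n (r ∸ 2))
    isEdgeG-unfold r σ R ∣R∣≡r with ∣ R ∣ ℕ.≟ r
    ... | yes _     = refl
    ... | no ∣R∣≢r = ⊥-elim (∣R∣≢r ∣R∣≡r)

    weightCondition⁻ : ∀ σ R S → weightCondition σ R S ≡ true → S ⊆ R → rWeight σ R S ≡ ℤ.+ 0
    weightCondition⁻ σ R S holds S⊆R with S ⊆? R
    ... | no S⊈R = ⊥-elim (S⊈R S⊆R)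
    ... | yes _ with rWeight σ R S ℤ.≟ ℤ.+ 0
    ...   | yes w≡0 = w≡0
    ...   | no _ with () ← holds

    weightCondition⁺ : ∀ σ R S → (S ⊆ R → rWeight σ R S ≡ ℤ.+ 0) → weightCondition σ R S ≡ true
    weightCondition⁺ σ R S w≡0 with S ⊆? R
    ... | no _ = refl
    ... | yes S⊆R with rWeight σ R S ℤ.≟ ℤ.+ 0
    ...   | yes _   = refl
    ...   | no w≢0 = ⊥-elim (w≢0 (w≡0 S⊆R))

  complement-of-two : ∀ {r} (R S : Subset n) → ∣ R ∣ ≡ r → 2 ≤ r → S ⊆ R → ∣ S ∣ ≡ r ∸ 2 →
                      ∃[ u ] ∃[ v ] (u ∈ R × v ∈ R × u Fin.< v × S ≡ R - u - v)
  complement-of-two {suc (suc r)} R S ∣R∣≡r (s≤s (s≤s _)) S⊆R ∣S∣≡r with elems (R ─ S) in eq | length-2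
    where
    length-2 : length (elems (R ─ S)) ≡ 2
    length-2 = trans (sym (∣p∣≡length-elems (R ─ S)))
      (ℕₚ.+-cancelˡ-≡ r _ _ (trans (cong (_+ ∣ R ─ S ∣) (sym ∣S∣≡r))
                                   (trans (sym (∣p∣≡∣q∣+∣p─q∣ R S S⊆R)) (trans ∣R∣≡r (ℕₚ.+-comm 2 r)))))
  ... | u ∷ v ∷ [] | _ = u , v , proj₁ u∈R─S , proj₁ v∈R─S , u<v , ⊆-antisym S⊆R-u-v R-u-v⊆S
    where
    ∈R─S : ∀ {z} → z ∈ₗ u ∷ v ∷ [] → z ∈ R × z ∉ S
    ∈R─S z∈ = x∈p─q⁻ R S (∈-elems⁻ (R ─ S) (subst (_ ∈ₗ_) (sym eq) z∈))
    u∈R─S = ∈R─S (here refl)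
    v∈R─S = ∈R─S (there (here refl))
    u<v : u Fin.< v
    u<v with (u<v ∷ []) ∷ _ ← subst StrictlyIncreasing eq (elems-increasing (R ─ S)) = u<v
    S⊆R-u-v : S ⊆ R - u - v
    S⊆R-u-v z∈S = x∈p∧x≢y,z⇒x∈p-y-z (S⊆R z∈S) (λ { refl → proj₂ u∈R─S z∈S }) (λ { refl → proj₂ v∈R─S z∈S })
    R-u-v⊆S : R - u - v ⊆ S
    R-u-v⊆S {z} z∈ with z ∈? S
    ... | yes z∈S = z∈S
    ... | no z∉S with x∈p-y-z⁻ R z∈
                    | subst (z ∈ₗ_) eq (∈-elems⁺ (R ─ S) (x∈p∧x∉q⇒x∈p─q {p = R} {q = S} (proj₁ (x∈p-y-z⁻ R z∈)) z∉S))
    ...   | _ , z≢u , _   | here z≡u         = ⊥-elim (z≢u z≡u)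
    ...   | _ , _   , z≢v | there (here z≡v) = ⊥-elim (z≢v z≡v)

  -- Once w₀ ∈ R is fixed, each facet R ∖ {w} of an edge R has exactly one admissible value of σ.
  facetGuesses : Subset n → Fin n → List Guess
  facetGuesses R w₀ = map (λ w → R - w , λ σ → facetSign σ R w₀ xor odd (#above R w)) (elems (R - w₀))

  guessed-facet⇔ : ∀ (σ : Tournament n) R {w₀} w → guessed σ (R - w , λ σ′ → facetSign σ′ R w₀ xor odd (#above R w)) ≡ true ⇔
                                  facetSign σ R w ≡ facetSign σ R w₀
  guessed-facet⇔ σ R {w₀} w = mk⇔ (Equivalence.to xor⇔ ∘ Equivalence.to ≟⇔) (Equivalence.from ≟⇔ ∘ Equivalence.from xor⇔)
    where
    ≟⇔ = ≟-true⇔≡ {σ (R - w)} {facetSign σ R w₀ xor odd (#above R w)}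
    xor⇔ = ≡xor⇔xor≡ {σ (R - w)} {facetSign σ R w₀} (odd (#above R w))

  module _ {r : ℕ} (σ : Tournament n) {R : Subset n} (∣R∣≡r : ∣ R ∣ ≡ r) where

    isEdgeG⇒facetSign≡ : isEdgeG r σ R ≡ true → ∀ {u v} → u ∈ R → v ∈ R → u Fin.< v → facetSign σ R u ≡ facetSign σ R v
    isEdgeG⇒facetSign≡ isEdge {u} {v} u∈R v∈R u<v = Equivalence.to (rWeight-zero⇔facetSign≡ σ R u∈R v∈R u<v)
      (weightCondition⁻ σ R (R - u - v)
        (allB⁻ (weightCondition σ R) (kSubsets n (r ∸ 2)) (trans (sym (isEdgeG-unfold r σ R ∣R∣≡r)) isEdge)
          (∈-kSubsets⁺ (R - u - v) (trans (∣p-x-y∣≡∣p∣∸2 R u∈R v∈R (Finₚ.<⇒≢ u<v)) (cong (_∸ 2) ∣R∣≡r))))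
        (λ z∈ → proj₁ (x∈p-y-z⁻ R z∈)))

    facetSign≡⇒isEdgeG : 2 ≤ r → (∀ {u v} → u ∈ R → v ∈ R → u Fin.< v → facetSign σ R u ≡ facetSign σ R v) →
                         isEdgeG r σ R ≡ true
    facetSign≡⇒isEdgeG 2≤r same = trans (isEdgeG-unfold r σ R ∣R∣≡r)
      (allB⁺ (weightCondition σ R) (kSubsets n (r ∸ 2)) λ {S} S∈ → weightCondition⁺ σ R S λ S⊆R →
        case complement-of-two R S ∣R∣≡r 2≤r S⊆R (∈-kSubsets⁻ S∈) of λ where
          (u , v , u∈R , v∈R , u<v , refl) → Equivalence.from (rWeight-zero⇔facetSign≡ σ R u∈R v∈R u<v) (same u∈R v∈R u<v))

    isEdgeG≡allGuessed : 2 ≤ r → ∀ {w₀} → w₀ ∈ R → isEdgeG r σ R ≡ allB (guessed σ) (facetGuesses R w₀)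
    isEdgeG≡allGuessed 2≤r {w₀} w₀∈R = ≡true-⇔⇒≡ to from
      where
      to : isEdgeG r σ R ≡ true → allB (guessed σ) (facetGuesses R w₀) ≡ true
      to isEdge = allB⁺ (guessed σ) (facetGuesses R w₀) each
        where
        same-as-w₀ : ∀ {w} → w ∈ R → facetSign σ R w ≡ facetSign σ R w₀
        same-as-w₀ {w} w∈R with Finₚ.<-cmp w w₀
        ... | tri< w<w₀ _ _ = isEdgeG⇒facetSign≡ isEdge w∈R w₀∈R w<w₀
        ... | tri≈ _ refl _ = refl
        ... | tri> _ _ w₀<w = sym (isEdgeG⇒facetSign≡ isEdge w₀∈R w∈R w₀<w)
        each : ∀ {h} → h ∈ₗ facetGuesses R w₀ → guessed σ h ≡ true
        each h∈ with ∈-map⁻ _ h∈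
        ... | w , w∈ , refl =
          Equivalence.from (guessed-facet⇔ σ R {w₀} w) (same-as-w₀ (proj₁ (x∈p-y⁻ R (∈-elems⁻ (R - w₀) w∈))))
      from : allB (guessed σ) (facetGuesses R w₀) ≡ true → isEdgeG r σ R ≡ true
      from allGuessed = facetSign≡⇒isEdgeG 2≤r λ u∈R v∈R _ → trans (same-as-w₀ u∈R) (sym (same-as-w₀ v∈R))
        where
        same-as-w₀ : ∀ {w} → w ∈ R → facetSign σ R w ≡ facetSign σ R w₀
        same-as-w₀ {w} w∈R with w Fin.≟ w₀
        ... | yes refl = refl
        ... | no w≢w₀  = Equivalence.to (guessed-facet⇔ σ R {w₀} w)
          (allB⁻ (guessed σ) (facetGuesses R w₀) allGuessed (∈-map⁺ _ (∈-elems⁺ (R - w₀) (x∈p∧x≢y⇒x∈p-y w∈R w≢w₀))))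

-- The probability that given r-sets are all edges

module _ {n : ℕ} (r : ℕ) where
  open import Data.Nat using (_+_; _*_; _≤_)
  open import Data.Rational using () renaming (_*_ to _*ℚ_)

  isEdgeG-local : ∀ (R : Subset n) {σ σ′} → (∀ S → S ⊆ R → σ S ≡ σ′ S) → isEdgeG r σ R ≡ isEdgeG r σ′ R
  isEdgeG-local R {σ} {σ′} σ≗σ′ =
    cong (⌊ ∣ R ∣ ℕ.≟ r ⌋ ∧_) (allB-cong (kSubsets n (r ∸ 2)) λ {S} _ → weightCondition-local S)
    where
    rWeight-local : ∀ S → S ⊆ R → rWeight σ R S ≡ rWeight σ′ R S
    rWeight-local S S⊆R = cong (List.foldr ℤ._+_ (ℤ.+ 0)) (Listₚ.map-cong-local (All.tabulate tSign-local))
      where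
      tSign-local : ∀ {v} → v ∈ₗ filter (λ v → ¬? (v ∈? S)) (elems R) → tSign σ S v ≡ tSign σ′ S v
      tSign-local {v} v∈ = cong (λ b → sgn b ℤ.* parity (inversions (elems S ++ v ∷ []))) (σ≗σ′ (S ∪ ⁅ v ⁆) S∪⁅v⁆⊆R)
        where
        S∪⁅v⁆⊆R : S ∪ ⁅ v ⁆ ⊆ R
        S∪⁅v⁆⊆R z∈ with x∈p∪q⁻ S ⁅ v ⁆ z∈
        ... | inj₁ z∈S = S⊆R z∈S
        ... | inj₂ z∈⁅v⁆ rewrite x∈⁅y⁆⇒x≡y v z∈⁅v⁆ = ∈-elems⁻ R (proj₁ (∈-filter⁻ (λ v → ¬? (v ∈? S)) {xs = elems R} v∈))
    weightCondition-local : ∀ S → (not ⌊ S ⊆? R ⌋ ∨ ⌊ rWeight σ R S ℤ.≟ ℤ.+ 0 ⌋)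
                                ≡ (not ⌊ S ⊆? R ⌋ ∨ ⌊ rWeight σ′ R S ℤ.≟ ℤ.+ 0 ⌋)
    weightCondition-local S with S ⊆? R
    ... | yes S⊆R = cong (λ w → ⌊ w ℤ.≟ ℤ.+ 0 ⌋) (rWeight-local S S⊆R)
    ... | no _    = refl

  isEdgeG-extensional : ∀ R → Extensional (λ σ → isEdgeG r σ R)
  isEdgeG-extensional R σ σ′ σ≗σ′ = isEdgeG-local R (λ S _ → σ≗σ′ S)

  isEdgeG-independent : ∀ {T} R → ¬ (T ⊆ R) → IndependentOf T (λ σ → isEdgeG r σ R)
  isEdgeG-independent R T⊈R σ b = isEdgeG-local R (λ S S⊆R → update-≢ σ _ b S (λ { refl → T⊈R S⊆R }))

  private
    LL : List (Subset n)
    LL = kSubsets n (r ∸ 1)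

  Pr-isEdgeG-∧ : 2 ≤ r → ∀ {R w₀} → ∣ R ∣ ≡ r → w₀ ∈ R → (P : Tournament n → Bool) → Extensional P →
                 (∀ {w} → w ∈ R → w ≢ w₀ → IndependentOf (R - w) P) →
                 Pr LL (λ σ → isEdgeG r σ R ∧ P σ) ≡ halfPow (r ∸ 1) *ℚ Pr LL P
  Pr-isEdgeG-∧ 2≤r {R} {w₀} ∣R∣≡r w₀∈R P extP indepP = begin
      Pr LL (λ σ → isEdgeG r σ R ∧ P σ)
    ≡⟨ avgOver-cong LL (λ σ → cong 𝟙 (trans (cong (_∧ P σ) (isEdgeG≡allGuessed σ ∣R∣≡r 2≤r w₀∈R))
                                           (Boolₚ.∧-comm _ (P σ)))) ⟩
      Pr LL (λ σ → P σ ∧ allB (guessed σ) gs)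
    ≡⟨ Pr-∧-allGuessed LL P gs (forFacets (λ w∈R _ → ∈-kSubsets⁺ (R - _) (trans (∣p-x∣≡∣p∣∸1 R w∈R) (cong (_∸ 1) ∣R∣≡r))))
         distinct extP (forFacets indepP) (forFacets (λ _ _ σ σ′ σ≗σ′ → cong (λ b → (b xor _) xor _) (σ≗σ′ (R - w₀))))
         indepGuesses ⟩
      halfPow (length gs) *ℚ Pr LL P
    ≡⟨ cong (λ k → halfPow k *ℚ Pr LL P) length-gs ⟩
      halfPow (r ∸ 1) *ℚ Pr LL P
    ∎
    where
    open ≡-Reasoning
    gs = facetGuesses R w₀
    guessOf : Fin n → Guess
    guessOf w = R - w , λ σ → facetSign σ R w₀ xor odd (#above R w)
    facet∈ : ∀ {w} → w ∈ₗ elems (R - w₀) → w ∈ R × w ≢ w₀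
    facet∈ w∈ = x∈p-y⁻ R (∈-elems⁻ (R - w₀) w∈)
    forFacets : ∀ {Q : Guess → Set} → (∀ {w} → w ∈ R → w ≢ w₀ → Q (guessOf w)) → All Q gs
    forFacets h = All.tabulate λ h∈ → case ∈-map⁻ guessOf h∈ of λ where
      (w , w∈ , refl) → let w∈R , w≢w₀ = facet∈ w∈ in h w∈R w≢w₀
    length-gs : length gs ≡ r ∸ 1
    length-gs = trans (Listₚ.length-map guessOf (elems (R - w₀)))
      (trans (sym (∣p∣≡length-elems (R - w₀))) (trans (∣p-x∣≡∣p∣∸1 R w₀∈R) (cong (_∸ 1) ∣R∣≡r)))
    distinct : AllPairs (λ (T , _) (T′ , _) → T ≢ T′) gs
    distinct = AllPairsₚ.map⁺ (AllPairs-map-∈ (λ _ w′∈ w<w′ eq → Finₚ.<⇒≢ w<w′ (p-x≡p-y⇒x≡y R (proj₁ (facet∈ w′∈)) eq))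
                                              (elems-increasing (R - w₀)))
    indepGuesses : ∀ {h h′} → h ∈ₗ gs → h′ ∈ₗ gs → IndependentOf (proj₁ h′) (proj₂ h)
    indepGuesses h∈ h′∈ with ∈-map⁻ guessOf h∈ | ∈-map⁻ guessOf h′∈
    ... | w , _ , refl | w′ , w′∈ , refl = λ σ b →
      cong (λ c → (c xor odd (#above R w₀)) xor odd (#above R w))
           (update-≢ σ (R - w′) b (R - w₀) (λ eq → proj₂ (facet∈ w′∈) (p-x≡p-y⇒x≡y R w₀∈R (sym eq))))

  HasFreshFacets : Subset n → List (Subset n) → Set
  HasFreshFacets R Rs = ∣ R ∣ ≡ r × ∃[ w₀ ] (w₀ ∈ R × (∀ {w} → w ∈ R → w ≢ w₀ → All (λ R′ → ¬ (R - w ⊆ R′)) Rs))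

  private
    allEdges-extensional : ∀ {A : Set} (f : A → Subset n) xs → Extensional (λ σ → allB (λ x → isEdgeG r σ (f x)) xs)
    allEdges-extensional f []       σ σ′ σ≗σ′ = refl
    allEdges-extensional f (x ∷ xs) σ σ′ σ≗σ′ =
      cong₂ _∧_ (isEdgeG-extensional (f x) σ σ′ σ≗σ′) (allEdges-extensional f xs σ σ′ σ≗σ′)

    allEdges-independent : ∀ {A : Set} (f : A → Subset n) {T} xs → All (λ x → ¬ (T ⊆ f x)) xs →
                           IndependentOf T (λ σ → allB (λ x → isEdgeG r σ (f x)) xs)
    allEdges-independent f []       []                σ b = refl
    allEdges-independent f (x ∷ xs) (T⊈fx ∷ T⊈fxs) σ b =
      cong₂ _∧_ (isEdgeG-independent (f x) T⊈fx σ b) (allEdges-independent f xs T⊈fxs σ b)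

  Pr-allEdges : 2 ≤ r → ∀ {A : Set} (f : A → Subset n) xs →
                (∀ pre x post → xs ≡ pre ++ x ∷ post → HasFreshFacets (f x) (map f post)) →
                Pr LL (λ σ → allB (λ x → isEdgeG r σ (f x)) xs) ≡ halfPow ((r ∸ 1) * length xs)
  Pr-allEdges 2≤r f []       _     = trans (avgOver-const LL 1ℚ) (cong halfPow (sym (ℕₚ.*-zeroʳ (r ∸ 1))))
  Pr-allEdges 2≤r f (x ∷ xs) fresh with fresh [] x xs refl
  ... | ∣fx∣≡r , w₀ , w₀∈fx , avoids = begin
      Pr LL (λ σ → isEdgeG r σ (f x) ∧ allB (λ y → isEdgeG r σ (f y)) xs)
    ≡⟨ Pr-isEdgeG-∧ 2≤r ∣fx∣≡r w₀∈fx _ (allEdges-extensional f xs)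
         (λ w∈fx w≢w₀ → allEdges-independent f xs (Allₚ.map⁻ (avoids w∈fx w≢w₀))) ⟩
      halfPow (r ∸ 1) *ℚ Pr LL (λ σ → allB (λ y → isEdgeG r σ (f y)) xs)
    ≡⟨ cong (halfPow (r ∸ 1) *ℚ_) (Pr-allEdges 2≤r f xs (λ pre y post eq → fresh (x ∷ pre) y post (cong (x ∷_) eq))) ⟩
      halfPow (r ∸ 1) *ℚ halfPow ((r ∸ 1) * length xs)
    ≡⟨ halfPow-+ (r ∸ 1) ((r ∸ 1) * length xs) ⟩
      halfPow ((r ∸ 1) + (r ∸ 1) * length xs)
    ≡⟨ cong halfPow (sym (ℕₚ.*-suc (r ∸ 1) (length xs))) ⟩
      halfPow ((r ∸ 1) * length (x ∷ xs))
    ∎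
    where
    open ≡-Reasoning

-- Injective images of a good ordering

module _ {k n : ℕ} (φ : Vec (Fin n) k) where

  private
    ⋃⁅_⁆ : List (Fin k) → Subset n
    ⋃⁅ xs ⁆ = List.foldr _∪_ ⊥ (map (λ v → ⁅ Vec.lookup φ v ⁆) xs)

    ∈-⋃⁺ : ∀ xs {x} → x ∈ₗ xs → Vec.lookup φ x ∈ ⋃⁅ xs ⁆
    ∈-⋃⁺ (x ∷ xs) (here refl) = x∈p∪q⁺ (inj₁ (x∈⁅x⁆ (Vec.lookup φ x)))
    ∈-⋃⁺ (x ∷ xs) (there x∈)  = x∈p∪q⁺ (inj₂ (∈-⋃⁺ xs x∈))

    ∈-⋃⁻ : ∀ xs {y} → y ∈ ⋃⁅ xs ⁆ → ∃[ x ] (x ∈ₗ xs × Vec.lookup φ x ≡ y)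
    ∈-⋃⁻ []       y∈ = ⊥-elim (∉⊥ y∈)
    ∈-⋃⁻ (x ∷ xs) y∈ with x∈p∪q⁻ ⁅ Vec.lookup φ x ⁆ ⋃⁅ xs ⁆ y∈
    ... | inj₁ y∈⁅φx⁆ = x , here refl , sym (x∈⁅y⁆⇒x≡y _ y∈⁅φx⁆)
    ... | inj₂ y∈⋃    = let z , z∈ , φz≡y = ∈-⋃⁻ xs y∈⋃ in z , there z∈ , φz≡y

    ∣⁅y⁆∪Y∣ : ∀ {m} (y : Fin m) (Y : Subset m) → y ∉ Y → ∣ ⁅ y ⁆ ∪ Y ∣ ≡ suc ∣ Y ∣
    ∣⁅y⁆∪Y∣ zero    (true  ∷ Y) y∉Y = ⊥-elim (y∉Y here)
    ∣⁅y⁆∪Y∣ zero    (false ∷ Y) y∉Y = cong (suc ∘ ∣_∣) (∪-identityˡ Y)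
    ∣⁅y⁆∪Y∣ (suc y) (true  ∷ Y) y∉Y = cong suc (∣⁅y⁆∪Y∣ y Y (y∉Y ∘ there))
    ∣⁅y⁆∪Y∣ (suc y) (false ∷ Y) y∉Y = ∣⁅y⁆∪Y∣ y Y (y∉Y ∘ there)

  ∈-image⁺ : ∀ e {b} → b ∈ e → Vec.lookup φ b ∈ image φ e
  ∈-image⁺ e b∈e = ∈-⋃⁺ (elems e) (∈-elems⁺ e b∈e)

  ∈-image⁻ : ∀ e {w} → w ∈ image φ e → ∃[ b ] (b ∈ e × Vec.lookup φ b ≡ w)
  ∈-image⁻ e w∈ = let b , b∈ , φb≡w = ∈-⋃⁻ (elems e) w∈ in b , ∈-elems⁻ e b∈ , φb≡w

  module _ (φ-injective : ∀ {a b} → Vec.lookup φ a ≡ Vec.lookup φ b → a ≡ b) where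

    ∣image∣≡∣e∣ : ∀ e → ∣ image φ e ∣ ≡ ∣ e ∣
    ∣image∣≡∣e∣ e = trans (∣⋃∣ (elems e) (AllPairs.map Finₚ.<⇒≢ (elems-increasing e))) (sym (∣p∣≡length-elems e))
      where
      ∣⋃∣ : ∀ xs → AllPairs _≢_ xs → ∣ ⋃⁅ xs ⁆ ∣ ≡ length xs
      ∣⋃∣ []       _            = ∣⊥∣≡0 n
      ∣⋃∣ (x ∷ xs) (x∉xs ∷ xs!) = trans (∣⁅y⁆∪Y∣ _ ⋃⁅ xs ⁆ φx∉) (cong suc (∣⋃∣ xs xs!))
        where
        φx∉ : Vec.lookup φ x ∉ ⋃⁅ xs ⁆
        φx∉ φx∈ = let z , z∈ , φz≡φx = ∈-⋃⁻ xs φx∈ in All.lookup x∉xs z∈ (sym (φ-injective φz≡φx))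

    image-─⊆⇒─⊆ : ∀ {x a b w} → Vec.lookup φ b ≡ w → image φ x - w ⊆ image φ a → x - b ⊆ a
    image-─⊆⇒─⊆ {x} {a} {b} refl ⊆a z∈ with x∈p-y⁻ x z∈
    ... | z∈x , z≢b with ∈-image⁻ a (⊆a (x∈p∧x≢y⇒x∈p-y (∈-image⁺ x z∈x) (z≢b ∘ φ-injective)))
    ...   | z′ , z′∈a , φz′≡φz = subst (_∈ a) (φ-injective φz′≡φz) z′∈a

    image-facets-outside : ∀ {x b₀} As → (∀ {b} → b ∈ x → b ≢ b₀ → All (λ a → ¬ (x - b ⊆ a)) As) →
      ∀ {w} → w ∈ image φ x → w ≢ Vec.lookup φ b₀ → All (λ R′ → ¬ (image φ x - w ⊆ R′)) (map (image φ) As)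
    image-facets-outside {x} As outside {w} w∈ w≢φb₀ with ∈-image⁻ x w∈
    ... | b , b∈x , φb≡w =
      Allₚ.map⁺ (All.map transport (outside b∈x (λ b≡b₀ → w≢φb₀ (trans (sym φb≡w) (cong (Vec.lookup φ) b≡b₀)))))
      where
      transport : ∀ {a} → ¬ (x - b ⊆ a) → ¬ (image φ x - w ⊆ image φ a)
      transport x-b⊈a ⊆a = x-b⊈a (image-─⊆⇒─⊆ φb≡w ⊆a)

module _ {k : ℕ} {r : ℕ} where
  open import Data.Nat using (_≤_; _<_)

  private
    ∣x∩a∣≡r∸1 : ∀ {x a : Subset k} {b} → ∣ x ∣ ≡ r → ∣ a ∣ ≡ r → x ≢ a → b ∈ x → x - b ⊆ a → ∣ x ∩ a ∣ ≡ r ∸ 1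
    ∣x∩a∣≡r∸1 {x} {a} {b} ∣x∣≡r ∣a∣≡r x≢a b∈x x-b⊆a = ℕₚ.≤-antisym upper lower
      where
      ∣x∣≡1+∣x-b∣ = ∣p∣≡1+∣p-x∣ x b∈x
      lower : r ∸ 1 ≤ ∣ x ∩ a ∣
      lower = ℕₚ.≤-trans (ℕₚ.≤-reflexive (cong (_∸ 1) (trans (sym ∣x∣≡r) ∣x∣≡1+∣x-b∣)))
                         (p⊆q⇒∣p∣≤∣q∣ (λ z∈ → x∈p∩q⁺ (proj₁ (x∈p-y⁻ x z∈) , x-b⊆a z∈)))
      ∣x∩a∣≢r : ∣ x ∩ a ∣ ≢ r
      ∣x∩a∣≢r ∣x∩a∣≡r = x≢a (⊆-antisym x⊆a (⊆∧∣≡∣⇒⊇ x⊆a (trans ∣x∣≡r (sym ∣a∣≡r))))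
        where
        x⊆a : x ⊆ a
        x⊆a z∈ = proj₂ (x∈p∩q⁻ x a (⊆∧∣≡∣⇒⊇ (p∩q⊆p x a) (trans ∣x∩a∣≡r (sym ∣x∣≡r)) z∈))
      upper : ∣ x ∩ a ∣ ≤ r ∸ 1
      upper = <⇒≤∸1 (ℕₚ.≤∧≢⇒< (ℕₚ.≤-trans (∣p∩q∣≤∣p∣ x a) (ℕₚ.≤-reflexive ∣x∣≡r)) ∣x∩a∣≢r)
        where
        <⇒≤∸1 : ∀ {m n} → m < n → m ≤ n ∸ 1
        <⇒≤∸1 (s≤s m≤n) = m≤n

    -- b₀ lies in none of the sets a ∈ As that meet x in r − 1 points: by the good-order
    -- condition these all meet x in the same (r − 1)-set, and b₀ is taken outside it.
    ∃-outside-neighbours : 1 ≤ r → ∀ {x : Subset k} {As} → ∣ x ∣ ≡ r →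
      (∀ {a a′} → a ∈ₗ As → a′ ∈ₗ As → ∣ x ∩ a ∣ ≡ r ∸ 1 → ∣ x ∩ a′ ∣ ≡ r ∸ 1 → x ∩ a ≡ x ∩ a′) →
      ∃[ b₀ ] (b₀ ∈ x × ∀ {a} → a ∈ₗ As → ∣ x ∩ a ∣ ≡ r ∸ 1 → b₀ ∉ a)
    ∃-outside-neighbours 1≤r {x} {As} ∣x∣≡r good with Any.any? (λ a → ∣ x ∩ a ∣ ℕ.≟ r ∸ 1) As
    ... | yes some = let _ , a₁∈ , ∣x∩a₁∣≡r∸1 = find some in outside a₁∈ ∣x∩a₁∣≡r∸1
      where
      outside : ∀ {a₁} → a₁ ∈ₗ As → ∣ x ∩ a₁ ∣ ≡ r ∸ 1 → ∃[ b₀ ] (b₀ ∈ x × ∀ {a} → a ∈ₗ As → ∣ x ∩ a ∣ ≡ r ∸ 1 → b₀ ∉ a)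
      outside {a₁} a₁∈ ∣x∩a₁∣≡r∸1 =
        let b₀ , b₀∈x , b₀∉a₁ = ⊈⇒∃∉ x a₁ x⊈a₁
        in b₀ , b₀∈x , λ a∈ ∣x∩a∣≡r∸1 b₀∈a →
             b₀∉a₁ (proj₂ (x∈p∩q⁻ x a₁ (subst (b₀ ∈_) (good a∈ a₁∈ ∣x∩a∣≡r∸1 ∣x∩a₁∣≡r∸1) (x∈p∩q⁺ (b₀∈x , b₀∈a)))))
        where
        x⊈a₁ : ¬ (x ⊆ a₁)
        x⊈a₁ x⊆a₁ = ℕₚ.<-irrefl (sym ∣x∩a₁∣≡r∸1)
          (ℕₚ.<-≤-trans (ℕₚ.∸-monoʳ-< {o = 0} (s≤s z≤n) 1≤r)
            (ℕₚ.≤-trans (ℕₚ.≤-reflexive (sym ∣x∣≡r)) (p⊆q⇒∣p∣≤∣q∣ (λ z∈ → x∈p∩q⁺ (z∈ , x⊆a₁ z∈)))))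
    ... | no none =
      let b₀ , b₀∈x , _ = ⊈⇒∃∉ x ⊥ x⊈⊥ in b₀ , b₀∈x , λ a∈ ∣x∩a∣≡r∸1 _ → none (lose a∈ ∣x∩a∣≡r∸1)
      where
      x⊈⊥ : ¬ (x ⊆ ⊥)
      x⊈⊥ x⊆⊥ = ℕₚ.<-irrefl refl (ℕₚ.<-≤-trans 1≤r
        (ℕₚ.≤-trans (ℕₚ.≤-reflexive (sym ∣x∣≡r)) (ℕₚ.≤-trans (p⊆q⇒∣p∣≤∣q∣ x⊆⊥) (ℕₚ.≤-reflexive (∣⊥∣≡0 k)))))

  fresh-facets : 1 ≤ r → ∀ {x : Subset k} {As} → ∣ x ∣ ≡ r → All (λ a → ∣ a ∣ ≡ r × x ≢ a) As →
    (∀ {a a′} → a ∈ₗ As → a′ ∈ₗ As → ∣ x ∩ a ∣ ≡ r ∸ 1 → ∣ x ∩ a′ ∣ ≡ r ∸ 1 → x ∩ a ≡ x ∩ a′) →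
    ∃[ b₀ ] (b₀ ∈ x × ∀ {b} → b ∈ x → b ≢ b₀ → All (λ a → ¬ (x - b ⊆ a)) As)
  fresh-facets 1≤r {x} {As} ∣x∣≡r others good =
    let b₀ , b₀∈x , b₀-outside = ∃-outside-neighbours 1≤r ∣x∣≡r good
    in b₀ , b₀∈x , λ b∈x b≢b₀ → All.tabulate λ a∈ x-b⊆a →
         let ∣a∣≡r , x≢a = All.lookup others a∈
         in b₀-outside a∈ (∣x∩a∣≡r∸1 ∣x∣≡r ∣a∣≡r x≢a b∈x x-b⊆a) (x-b⊆a (x∈p∧x≢y⇒x∈p-y b₀∈x (b≢b₀ ∘ sym)))

GoodOrder-++-∷ : ∀ {k} r (pre : List (Subset k)) x post → GoodOrder r (pre ++ x ∷ post) →
  ∀ {a a′} → a ∈ₗ pre → a′ ∈ₗ pre → ∣ x ∩ a ∣ ≡ r ∸ 1 → ∣ x ∩ a′ ∣ ≡ r ∸ 1 → x ∩ a ≡ x ∩ a′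
GoodOrder-++-∷ {k} r pre x post good {a} {a′} a∈ a′∈ ∣x∩a∣ ∣x∩a′∣ with position-++-∷ pre x post
... | i , xᵢ≡x , earlier with earlier a∈ | earlier a′∈
...   | j , j<i , xⱼ≡a | j′ , j′<i , xⱼ′≡a′ = at-positions xᵢ≡x xⱼ≡a xⱼ′≡a′ (good i j j′ j<i j′<i)
  where
  at-positions : ∀ {y b b′ : Subset k} → y ≡ x → b ≡ a → b′ ≡ a′ →
                 (∣ y ∩ b ∣ ≡ r ∸ 1 → ∣ y ∩ b′ ∣ ≡ r ∸ 1 → y ∩ b ≡ y ∩ b′) → x ∩ a ≡ x ∩ a′
  at-positions refl refl refl h = h ∣x∩a∣ ∣x∩a′∣

module _ {n r : ℕ} where
  open import Data.Nat using (_*_; _≤_)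

  Pr-allImageEdges : 2 ≤ r → (H : Hypergraph r) → AdmitsGoodOrder H →
                     (φ : Vec (Fin n) (nV H)) → (∀ {a b} → Vec.lookup φ a ≡ Vec.lookup φ b → a ≡ b) →
                     Pr (kSubsets n (r ∸ 1)) (λ σ → allB (λ e → isEdgeG r σ (image φ e)) (edges H))
                       ≡ halfPow ((r ∸ 1) * eH H)
  Pr-allImageEdges 2≤r H (es , es↭edges , good) φ φ-injective = begin
      Pr LL (λ σ → allB (λ e → isEdgeG r σ (image φ e)) (edges H))
    ≡⟨ avgOver-cong LL (λ σ → cong 𝟙 (allB-↭ (λ e → isEdgeG r σ (image φ e)) (↭-sym reverse-es↭edges))) ⟩
      Pr LL (λ σ → allB (λ e → isEdgeG r σ (image φ e)) (reverse es))
    ≡⟨ Pr-allEdges r 2≤r (image φ) (reverse es) fresh ⟩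
      halfPow ((r ∸ 1) * length (reverse es))
    ≡⟨ cong (λ m → halfPow ((r ∸ 1) * m)) (↭-length reverse-es↭edges) ⟩
      halfPow ((r ∸ 1) * eH H)
    ∎
    where
    open ≡-Reasoning
    LL = kSubsets n (r ∸ 1)
    reverse-es↭edges : reverse es ↭ edges H
    reverse-es↭edges = _↭_.trans (↭-reverse es) es↭edges
    es-unique : AllPairs _≢_ es
    es-unique = Permutationₛₚ.Unique-resp-↭ (setoid _) (↭⇒↭ₛ (↭-sym es↭edges)) (unique H)
    ∣e∣≡r : ∀ {e} → e ∈ₗ es → ∣ e ∣ ≡ r
    ∣e∣≡r e∈ = All.lookup (unif H) (∈-resp-↭ es↭edges e∈)
    fresh : ∀ pre x post → reverse es ≡ pre ++ x ∷ post → HasFreshFacets r (image φ x) (map (image φ) post)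
    fresh pre x post eq =
      let b₀ , b₀∈x , b₀-fresh = fresh-facets (ℕₚ.≤-trans (s≤s z≤n) 2≤r) (∣e∣≡r x∈es) others
                                   (λ a∈ a′∈ → GoodOrder-++-∷ r (reverse post) x (reverse pre) (subst (GoodOrder r) es≡ good)
                                                 (Anyₚ.reverse⁺ a∈) (Anyₚ.reverse⁺ a′∈))
      in trans (∣image∣≡∣e∣ φ φ-injective x) (∣e∣≡r x∈es) , Vec.lookup φ b₀ , ∈-image⁺ φ x b₀∈x ,
         image-facets-outside φ φ-injective post b₀-fresh
      where
      es≡ : es ≡ reverse post ++ x ∷ reverse pre
      es≡ = reverse-≡-++-∷ es pre x post eq
      x∈es : x ∈ₗ es
      x∈es = subst (x ∈ₗ_) (sym es≡) (∈-++⁺ʳ (reverse post) (here refl))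
      others : All (λ a → ∣ a ∣ ≡ r × x ≢ a) post
      others = All.tabulate λ a∈ →
        let a∈es = subst (_ ∈ₗ_) (sym es≡) (∈-++⁺ˡ (Anyₚ.reverse⁺ a∈))
        in ∣e∣≡r a∈es , λ x≡a → AllPairs-++-∷ (reverse post) x (reverse pre) (subst (AllPairs _≢_) es≡ es-unique)
                                  (Anyₚ.reverse⁺ a∈) (sym x≡a)

-- Counting non-injective maps

module _ where
  open import Data.Nat using (_+_; _*_; _^_; _≤_)
  open import Data.Nat.ListAction using (sum)
  open import Data.Nat.ListAction.Properties using (sum-++)
  open import Data.Nat.Solver using (module +-*-Solver)
  open +-*-Solver

  𝟙ℕ : Bool → ℕ
  𝟙ℕ true  = 1
  𝟙ℕ false = 0

  count : ∀ {A : Set} → (A → Bool) → List A → ℕ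
  count P xs = sum (map (𝟙ℕ ∘ P) xs)

  length-filter≡count : ∀ {A : Set} (P : A → Bool) xs → length (filter (λ x → P x Boolₚ.≟ true) xs) ≡ count P xs
  length-filter≡count P []       = refl
  length-filter≡count P (x ∷ xs) with P x
  ... | true  = cong suc (length-filter≡count P xs)
  ... | false = length-filter≡count P xs

  sum-map-const : ∀ {A : Set} c (xs : List A) → sum (map (λ _ → c) xs) ≡ length xs * c
  sum-map-const c []       = refl
  sum-map-const c (x ∷ xs) = cong (c +_) (sum-map-const c xs)

  sum-map-cong : ∀ {A : Set} {f g : A → ℕ} xs → (∀ x → f x ≡ g x) → sum (map f xs) ≡ sum (map g xs)
  sum-map-cong xs f≗g = cong sum (Listₚ.map-cong f≗g xs)

  sum-map-mono : ∀ {A : Set} {f g : A → ℕ} xs → (∀ x → f x ≤ g x) → sum (map f xs) ≤ sum (map g xs)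
  sum-map-mono []       f≤g = z≤n
  sum-map-mono (x ∷ xs) f≤g = ℕₚ.+-mono-≤ (f≤g x) (sum-map-mono xs f≤g)

  sum-map-+ : ∀ {A : Set} (f g : A → ℕ) xs → sum (map (λ x → f x + g x) xs) ≡ sum (map f xs) + sum (map g xs)
  sum-map-+ f g []       = refl
  sum-map-+ f g (x ∷ xs) rewrite sum-map-+ f g xs =
    solve 4 (λ a b c d → (a :+ b) :+ (c :+ d) := (a :+ c) :+ (b :+ d)) refl (f x) (g x) (sum (map f xs)) (sum (map g xs))

  sum-map-swap : ∀ {A B : Set} (f : A → B → ℕ) xs ys →
                 sum (map (λ x → sum (map (f x) ys)) xs) ≡ sum (map (λ y → sum (map (λ x → f x y) xs)) ys)
  sum-map-swap f []       ys = sym (trans (sum-map-const 0 ys) (ℕₚ.*-zeroʳ (length ys)))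
  sum-map-swap f (x ∷ xs) ys =
    trans (cong (sum (map (f x) ys) +_) (sum-map-swap f xs ys)) (sym (sum-map-+ (f x) _ ys))

  count-map : ∀ {A B : Set} (P : B → Bool) (g : A → B) xs → count P (map g xs) ≡ count (P ∘ g) xs
  count-map P g xs = cong sum (sym (Listₚ.map-∘ xs))

  count-concatMap : ∀ {A B : Set} (P : B → Bool) (f : A → List B) xs →
                    count P (List.concatMap f xs) ≡ sum (map (count P ∘ f) xs)
  count-concatMap P f []       = refl
  count-concatMap P f (x ∷ xs) = begin
      sum (map (𝟙ℕ ∘ P) (f x ++ List.concatMap f xs))
    ≡⟨ cong sum (Listₚ.map-++ (𝟙ℕ ∘ P) (f x) _) ⟩
      sum (map (𝟙ℕ ∘ P) (f x) ++ map (𝟙ℕ ∘ P) (List.concatMap f xs))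
    ≡⟨ sum-++ (map (𝟙ℕ ∘ P) (f x)) _ ⟩
      count P (f x) + count P (List.concatMap f xs)
    ≡⟨ cong (count P (f x) +_) (count-concatMap P f xs) ⟩
      sum (map (count P ∘ f) (x ∷ xs))
    ∎
    where open ≡-Reasoning

  count-const-true : ∀ {A : Set} (xs : List A) → count (λ _ → true) xs ≡ length xs
  count-const-true xs = trans (sum-map-const 1 xs) (ℕₚ.*-identityʳ (length xs))

  count-allFin-≟ : ∀ n (y : Fin n) → count (λ x → ⌊ x Fin.≟ y ⌋) (List.allFin n) ≡ 1
  count-allFin-≟ (suc n) y = begin
      𝟙ℕ ⌊ zero Fin.≟ y ⌋ + count (λ x → ⌊ x Fin.≟ y ⌋) (List.tabulate suc)
    ≡⟨ cong (λ xs → 𝟙ℕ ⌊ zero Fin.≟ y ⌋ + count (λ x → ⌊ x Fin.≟ y ⌋) xs) (sym (Listₚ.map-tabulate id suc)) ⟩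
      𝟙ℕ ⌊ zero Fin.≟ y ⌋ + count (λ x → ⌊ x Fin.≟ y ⌋) (map suc (List.allFin n))
    ≡⟨ cong (𝟙ℕ ⌊ zero Fin.≟ y ⌋ +_) (count-map (λ x → ⌊ x Fin.≟ y ⌋) suc (List.allFin n)) ⟩
      𝟙ℕ ⌊ zero Fin.≟ y ⌋ + count (λ x → ⌊ suc x Fin.≟ y ⌋) (List.allFin n)
    ≡⟨ by-cases y ⟩
      1
    ∎
    where
    open ≡-Reasoning
    by-cases : ∀ y → 𝟙ℕ ⌊ zero Fin.≟ y ⌋ + count (λ x → ⌊ suc x Fin.≟ y ⌋) (List.allFin n) ≡ 1
    by-cases zero    = cong suc (trans (sum-map-const 0 (List.allFin n)) (ℕₚ.*-zeroʳ (length (List.allFin n))))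
    by-cases (suc y) = trans (sum-map-cong (List.allFin n) suc≟suc) (count-allFin-≟ n y)
      where
      suc≟suc : ∀ x → 𝟙ℕ ⌊ suc x Fin.≟ suc y ⌋ ≡ 𝟙ℕ ⌊ x Fin.≟ y ⌋
      suc≟suc x with x Fin.≟ y
      ... | yes refl = refl
      ... | no _     = refl

  length-allFin : ∀ n → length (List.allFin n) ≡ n
  length-allFin n = Listₚ.length-tabulate {n = n} id

  length-allMaps : ∀ k n → length (allMaps k n) ≡ n ^ k
  length-allMaps zero    n = refl
  length-allMaps (suc k) n = begin
      length (List.concatMap (λ x → map (x ∷_) (allMaps k n)) (List.allFin n))
    ≡⟨ sym (count-const-true (List.concatMap (λ x → map (x ∷_) (allMaps k n)) (List.allFin n))) ⟩
      count (λ _ → true) (List.concatMap (λ x → map (x ∷_) (allMaps k n)) (List.allFin n))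
    ≡⟨ count-concatMap (λ _ → true) (λ x → map (x ∷_) (allMaps k n)) (List.allFin n) ⟩
      sum (map (λ x → count (λ _ → true) (map (x ∷_) (allMaps k n))) (List.allFin n))
    ≡⟨ sum-map-cong (List.allFin n) (λ x → trans (count-const-true (map (x ∷_) (allMaps k n)))
                                          (trans (Listₚ.length-map (x ∷_) (allMaps k n)) (length-allMaps k n))) ⟩
      sum (map (λ _ → n ^ k) (List.allFin n))
    ≡⟨ trans (sum-map-const (n ^ k) (List.allFin n)) (cong (_* n ^ k) (length-allFin n)) ⟩
      n * n ^ k
    ∎
    where open ≡-Reasoning

  module _ {n : ℕ} where

    occursᵇ : ∀ {k} → Fin n → Vec (Fin n) k → Bool
    occursᵇ x []      = false
    occursᵇ x (y ∷ v) = ⌊ x Fin.≟ y ⌋ ∨ occursᵇ x v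

    injectiveᵇ : ∀ {k} → Vec (Fin n) k → Bool
    injectiveᵇ []      = true
    injectiveᵇ (x ∷ v) = not (occursᵇ x v) ∧ injectiveᵇ v

    occursᵇ-lookup : ∀ {k} (v : Vec (Fin n) k) i → occursᵇ (Vec.lookup v i) v ≡ true
    occursᵇ-lookup (x ∷ v) zero    with x Fin.≟ x
    ... | yes _  = refl
    ... | no x≢x = ⊥-elim (x≢x refl)
    occursᵇ-lookup (x ∷ v) (suc i) = trans (cong (⌊ Vec.lookup v i Fin.≟ x ⌋ ∨_) (occursᵇ-lookup v i)) (Boolₚ.∨-zeroʳ _)

    injectiveᵇ-sound : ∀ {k} (v : Vec (Fin n) k) → injectiveᵇ v ≡ true → ∀ {a b} → Vec.lookup v a ≡ Vec.lookup v b → a ≡ b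
    injectiveᵇ-sound (x ∷ v) inj {zero}  {zero}  _  = refl
    injectiveᵇ-sound (x ∷ v) inj {suc a} {suc b} eq with occursᵇ x v
    ... | false = cong suc (injectiveᵇ-sound v inj eq)
    injectiveᵇ-sound (x ∷ v) inj {zero}  {suc b} eq with occursᵇ x v in x∈v
    ... | false with () ← trans (sym x∈v) (subst (λ y → occursᵇ y v ≡ true) (sym eq) (occursᵇ-lookup v b))
    injectiveᵇ-sound (x ∷ v) inj {suc a} {zero}  eq with occursᵇ x v in x∈v
    ... | false with () ← trans (sym x∈v) (subst (λ y → occursᵇ y v ≡ true) eq (occursᵇ-lookup v a))

    count-occursᵇ : ∀ {k} (v : Vec (Fin n) k) → count (λ x → occursᵇ x v) (List.allFin n) ≤ k
    count-occursᵇ []      = ℕₚ.≤-reflexive (trans (sum-map-const 0 (List.allFin n)) (ℕₚ.*-zeroʳ (length (List.allFin n))))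
    count-occursᵇ (y ∷ v) = begin
        count (λ x → ⌊ x Fin.≟ y ⌋ ∨ occursᵇ x v) (List.allFin n)
      ≤⟨ sum-map-mono (List.allFin n) (λ x → 𝟙ℕ-∨ ⌊ x Fin.≟ y ⌋ (occursᵇ x v)) ⟩
        sum (map (λ x → 𝟙ℕ ⌊ x Fin.≟ y ⌋ + 𝟙ℕ (occursᵇ x v)) (List.allFin n))
      ≡⟨ sum-map-+ (λ x → 𝟙ℕ ⌊ x Fin.≟ y ⌋) (λ x → 𝟙ℕ (occursᵇ x v)) (List.allFin n) ⟩
        count (λ x → ⌊ x Fin.≟ y ⌋) (List.allFin n) + count (λ x → occursᵇ x v) (List.allFin n)
      ≤⟨ ℕₚ.+-mono-≤ (ℕₚ.≤-reflexive (count-allFin-≟ n y)) (count-occursᵇ v) ⟩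
        suc _
      ∎
      where
      open ℕₚ.≤-Reasoning
      𝟙ℕ-∨ : ∀ a b → 𝟙ℕ (a ∨ b) ≤ 𝟙ℕ a + 𝟙ℕ b
      𝟙ℕ-∨ true  b = s≤s z≤n
      𝟙ℕ-∨ false b = ℕₚ.≤-refl

  #nonInjective : ℕ → ℕ → ℕ
  #nonInjective k n = count (not ∘ injectiveᵇ) (allMaps k n)

  -- x ∷ v fails to be injective only if x occurs in v or v is not injective; summing
  -- the first case over x counts every v at most k times.
  #nonInjective-suc : ∀ k n → #nonInjective (suc k) n ≤ n ^ k * k + n * #nonInjective k n
  #nonInjective-suc k n = begin
      count (not ∘ injectiveᵇ) (List.concatMap (λ x → map (x ∷_) Φ) (List.allFin n))
    ≡⟨ count-concatMap (not ∘ injectiveᵇ) (λ x → map (x ∷_) Φ) (List.allFin n) ⟩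
      sum (map (λ x → count (not ∘ injectiveᵇ) (map (x ∷_) Φ)) (List.allFin n))
    ≡⟨ sum-map-cong (List.allFin n) (λ x → count-map (not ∘ injectiveᵇ) (x ∷_) Φ) ⟩
      sum (map (λ x → count (λ v → not (injectiveᵇ (x ∷ v))) Φ) (List.allFin n))
    ≤⟨ sum-map-mono (List.allFin n) (λ x → sum-map-mono Φ (𝟙ℕ-nonInjective-∷ x)) ⟩
      sum (map (λ x → sum (map (λ v → 𝟙ℕ (occursᵇ x v) + 𝟙ℕ (not (injectiveᵇ v))) Φ)) (List.allFin n))
    ≡⟨ sum-map-cong (List.allFin n) (λ x → sum-map-+ (λ v → 𝟙ℕ (occursᵇ x v)) (λ v → 𝟙ℕ (not (injectiveᵇ v))) Φ) ⟩
      sum (map (λ x → count (occursᵇ x) Φ + #nonInjective k n) (List.allFin n))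
    ≡⟨ sum-map-+ (λ x → count (occursᵇ x) Φ) (λ _ → #nonInjective k n) (List.allFin n) ⟩
      sum (map (λ x → count (occursᵇ x) Φ) (List.allFin n)) + sum (map (λ _ → #nonInjective k n) (List.allFin n))
    ≡⟨ cong₂ _+_ (sum-map-swap (λ x v → 𝟙ℕ (occursᵇ x v)) (List.allFin n) Φ)
                 (trans (sum-map-const (#nonInjective k n) (List.allFin n))
                        (cong (_* #nonInjective k n) (length-allFin n))) ⟩
      sum (map (λ v → count (λ x → occursᵇ x v) (List.allFin n)) Φ) + n * #nonInjective k n
    ≤⟨ ℕₚ.+-monoˡ-≤ (n * #nonInjective k n) (sum-map-mono Φ count-occursᵇ) ⟩
      sum (map (λ _ → k) Φ) + n * #nonInjective k n
    ≡⟨ cong (_+ n * #nonInjective k n) (trans (sum-map-const k Φ) (cong (_* k) (length-allMaps k n))) ⟩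
      n ^ k * k + n * #nonInjective k n
    ∎
    where
    open ℕₚ.≤-Reasoning
    Φ = allMaps k n
    𝟙ℕ-nonInjective-∷ : ∀ x v → 𝟙ℕ (not (injectiveᵇ (x ∷ v))) ≤ 𝟙ℕ (occursᵇ x v) + 𝟙ℕ (not (injectiveᵇ v))
    𝟙ℕ-nonInjective-∷ x v with occursᵇ x v | injectiveᵇ v
    ... | true  | _     = s≤s z≤n
    ... | false | true  = z≤n
    ... | false | false = ℕₚ.≤-refl

  #nonInjective*n≤k²n^k : ∀ k n → #nonInjective k n * n ≤ k * k * n ^ k
  #nonInjective*n≤k²n^k zero    n = z≤n
  #nonInjective*n≤k²n^k (suc k) n = begin
      #nonInjective (suc k) n * n
    ≤⟨ ℕₚ.*-monoˡ-≤ n (#nonInjective-suc k n) ⟩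
      (n ^ k * k + n * #nonInjective k n) * n
    ≡⟨ solve 4 (λ P k n b → (P :* k :+ n :* b) :* n := k :* (n :* P) :+ n :* (b :* n)) refl (n ^ k) k n (#nonInjective k n) ⟩
      k * (n * n ^ k) + n * (#nonInjective k n * n)
    ≤⟨ ℕₚ.+-monoʳ-≤ (k * (n * n ^ k)) (ℕₚ.*-monoʳ-≤ n (#nonInjective*n≤k²n^k k n)) ⟩
      k * (n * n ^ k) + n * (k * k * n ^ k)
    ≡⟨ solve 3 (λ P k n → k :* (n :* P) :+ n :* (k :* k :* P) := (k :+ k :* k) :* (n :* P)) refl (n ^ k) k n ⟩
      (k + k * k) * (n * n ^ k)
    ≤⟨ ℕₚ.*-monoˡ-≤ (n * n ^ k) (ℕₚ.≤-trans (ℕₚ.m≤n+m (k + k * k) (suc k))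
         (ℕₚ.≤-reflexive (solve 1 (λ k → (con 1 :+ k) :+ (k :+ k :* k) := (con 1 :+ k) :* (con 1 :+ k)) refl k))) ⟩
      suc k * suc k * (n * n ^ k)
    ∎
    where open ℕₚ.≤-Reasoning

-- Rationals and convergence

module _ where
  open import Data.Nat using (_+_; _*_; _≤_; _<_)
  open import Data.Rational using (mkℚ; _/_; toℚᵘ) renaming (_+_ to _+ℚ_; _*_ to _*ℚ_; _≤_ to _≤ℚ_; _<_ to _<ℚ_)
  open import Data.Rational.Unnormalised as ℚᵘ using (mkℚᵘ; *≡*; *≤*; *<*; _≃_)
  import Data.Rational.Unnormalised.Properties as ℚᵘₚ
  open import Data.Integer.Solver using (module +-*-Solver)
  open +-*-Solver

  fromℕ : ℕ → ℚ
  fromℕ m = ℤ.+ m / 1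

  toℚᵘ-/ : ∀ i d → toℚᵘ (i / suc d) ≃ mkℚᵘ i d
  toℚᵘ-/ i d = ℚₚ./-injective-≃ (toℚᵘ (i / suc d)) (mkℚᵘ i d) (↥/↧ (i / suc d))
    where
    ↥/↧ : ∀ p → ℚᵘ.↥ (toℚᵘ p) / ℚᵘ.↧ₙ (toℚᵘ p) ≡ p
    ↥/↧ p@(mkℚ _ _ _) = ℚₚ.↥p/↧p≡p p

  fromℕ-+ : ∀ a b → fromℕ (a + b) ≡ fromℕ a +ℚ fromℕ b
  fromℕ-+ a b = ℚₚ.toℚᵘ-injective (ℚᵘₚ.≃-trans (toℚᵘ-/ (ℤ.+ (a + b)) 0) (ℚᵘₚ.≃-trans unnormalised
    (ℚᵘₚ.≃-sym (ℚᵘₚ.≃-trans (ℚₚ.toℚᵘ-homo-+ (fromℕ a) (fromℕ b)) (ℚᵘₚ.+-cong (toℚᵘ-/ (ℤ.+ a) 0) (toℚᵘ-/ (ℤ.+ b) 0))))))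
    where
    unnormalised : mkℚᵘ (ℤ.+ (a + b)) 0 ≃ mkℚᵘ (ℤ.+ a) 0 ℚᵘ.+ mkℚᵘ (ℤ.+ b) 0
    unnormalised = *≡* (trans (cong (ℤ._* ℤ.+ 1) (ℤₚ.pos-+ a b))
      (solve 2 (λ x y → (x :+ y) :* con (ℤ.+ 1) := (x :* con (ℤ.+ 1) :+ y :* con (ℤ.+ 1)) :* con (ℤ.+ 1))
               refl (ℤ.+ a) (ℤ.+ b)))

  /≡fromℕ*1/ : ∀ a b → ℤ.+ a / suc b ≡ fromℕ a *ℚ (ℤ.+ 1 / suc b)
  /≡fromℕ*1/ a b = ℚₚ.toℚᵘ-injective (ℚᵘₚ.≃-trans (toℚᵘ-/ (ℤ.+ a) b) (ℚᵘₚ.≃-trans unnormalised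
    (ℚᵘₚ.≃-sym (ℚᵘₚ.≃-trans (ℚₚ.toℚᵘ-homo-* (fromℕ a) (ℤ.+ 1 / suc b)) (ℚᵘₚ.*-cong (toℚᵘ-/ (ℤ.+ a) 0) (toℚᵘ-/ (ℤ.+ 1) b))))))
    where
    unnormalised : mkℚᵘ (ℤ.+ a) b ≃ mkℚᵘ (ℤ.+ a) 0 ℚᵘ.* mkℚᵘ (ℤ.+ 1) b
    unnormalised = *≡* (trans (cong (λ z → ℤ.+ a ℤ.* ℤ.+ suc z) (ℕₚ.+-identityʳ b))
                              (solve 2 (λ x y → x :* y := (x :* con (ℤ.+ 1)) :* y) refl (ℤ.+ a) (ℤ.+ suc b)))

  fromℕ*1/≡1 : ∀ b → fromℕ (suc b) *ℚ (ℤ.+ 1 / suc b) ≡ 1ℚ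
  fromℕ*1/≡1 b = trans (sym (/≡fromℕ*1/ (suc b) b))
    (ℚₚ.toℚᵘ-injective (ℚᵘₚ.≃-trans (toℚᵘ-/ (ℤ.+ suc b) b) (*≡* (ℤₚ.*-comm (ℤ.+ suc b) (ℤ.+ 1)))))

  /-mono-≤ : ∀ a b c d → a * suc d ≤ c * suc b → ℤ.+ a / suc b ≤ℚ ℤ.+ c / suc d
  /-mono-≤ a b c d ad≤cb = ℚₚ.toℚᵘ-cancel-≤ (ℚᵘₚ.≤-respˡ-≃ (ℚᵘₚ.≃-sym (toℚᵘ-/ (ℤ.+ a) b))
    (ℚᵘₚ.≤-respʳ-≃ (ℚᵘₚ.≃-sym (toℚᵘ-/ (ℤ.+ c) d))
      (*≤* (subst₂ ℤ._≤_ (ℤₚ.pos-* a (suc d)) (ℤₚ.pos-* c (suc b)) (ℤ.+≤+ ad≤cb)))))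

  ConvergesTo-O[1/n] : ∀ (a : ℕ → ℚ) L K → (∀ m → ℚ.∣ a (suc m) ℚ.- L ∣ ≤ℚ ℤ.+ K / suc m) → ConvergesTo a L
  ConvergesTo-O[1/n] a L K close ε@(mkℚ (ℤ.+ suc p) q _) _ = suc (K * suc q) , eventually
    where
    K/n<ε : ∀ m → K * suc q < suc p * suc m → ℤ.+ K / suc m <ℚ ε
    K/n<ε m Kq<pm = ℚₚ.toℚᵘ-cancel-< (ℚᵘₚ.<-respˡ-≃ (ℚᵘₚ.≃-sym (toℚᵘ-/ (ℤ.+ K) m))
      (*<* (subst₂ ℤ._<_ (ℤₚ.pos-* K (suc q)) (ℤₚ.pos-* (suc p) (suc m)) (ℤ.+<+ Kq<pm))))
    eventually : ∀ n → suc (K * suc q) ≤ n → ℚ.∣ a n ℚ.- L ∣ <ℚ ε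
    eventually (suc m) (s≤s Kq≤m) = ℚₚ.≤-<-trans (close m) (K/n<ε m (ℕₚ.<-≤-trans (s≤s Kq≤m) (ℕₚ.m≤n*m (suc m) (suc p))))
  ConvergesTo-O[1/n] a L K close (mkℚ (ℤ.+ 0)     _ _) (ℚ.*<* (ℤ.+<+ ()))
  ConvergesTo-O[1/n] a L K close (mkℚ ℤ.-[1+ _ ] _ _) (ℚ.*<* ())

-- The expected homomorphism density

module _ where
  open import Data.Nat using (_^_) renaming (_+_ to _+ℕ_; _*_ to _*ℕ_; _≤_ to _≤ℕ_)
  open import Data.Rational using (_+_; _*_; _≤_; _/_)
  open import Data.Rational.Solver using (module +-*-Solver)
  open +-*-Solver

  sumℚ-𝟙 : ∀ {A : Set} (P : A → Bool) xs → sumℚ (map (𝟙 ∘ P) xs) ≡ fromℕ (count P xs)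
  sumℚ-𝟙 P []       = refl
  sumℚ-𝟙 P (x ∷ xs) = trans (cong₂ _+_ (𝟙≡fromℕ (P x)) (sumℚ-𝟙 P xs)) (sym (fromℕ-+ (𝟙ℕ (P x)) (count P xs)))
    where
    𝟙≡fromℕ : ∀ b → 𝟙 b ≡ fromℕ (𝟙ℕ b)
    𝟙≡fromℕ true  = refl
    𝟙≡fromℕ false = refl

  sumℚ-+ : ∀ {A : Set} (f g : A → ℚ) xs → sumℚ (map (λ x → f x + g x) xs) ≡ sumℚ (map f xs) + sumℚ (map g xs)
  sumℚ-+ f g []       = refl
  sumℚ-+ f g (x ∷ xs) rewrite sumℚ-+ f g xs =
    solve 4 (λ a b c d → (a :+ b) :+ (c :+ d) := (a :+ c) :+ (b :+ d)) refl (f x) (g x) (sumℚ (map f xs)) (sumℚ (map g xs))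

  sumℚ-const : ∀ {A : Set} c (xs : List A) → sumℚ (map (λ _ → c) xs) ≡ fromℕ (length xs) * c
  sumℚ-const c []       = sym (ℚₚ.*-zeroˡ c)
  sumℚ-const c (x ∷ xs) rewrite sumℚ-const c xs | fromℕ-+ 1 (length xs) =
    solve 2 (λ c l → c :+ l :* c := (con 1ℚ :+ l) :* c) refl c (fromℕ (length xs))

  ∣sumℚ-sumℚ∣≤ : ∀ {A : Set} (a : A → ℚ) c (t : A → ℚ) → (∀ x → ℚ.∣ a x ℚ.- c ∣ ≤ t x) → ∀ xs →
                 ℚ.∣ sumℚ (map a xs) ℚ.- sumℚ (map (λ _ → c) xs) ∣ ≤ sumℚ (map t xs)
  ∣sumℚ-sumℚ∣≤ a c t close []       = ℚₚ.≤-refl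
  ∣sumℚ-sumℚ∣≤ a c t close (x ∷ xs) = begin
      ℚ.∣ (a x + A) ℚ.- (c + C) ∣
    ≡⟨ cong ℚ.∣_∣ (solve 4 (λ a A c C → (a :+ A) :- (c :+ C) := (a :- c) :+ (A :- C)) refl (a x) A c C) ⟩
      ℚ.∣ (a x ℚ.- c) + (A ℚ.- C) ∣
    ≤⟨ ℚₚ.∣p+q∣≤∣p∣+∣q∣ (a x ℚ.- c) (A ℚ.- C) ⟩
      ℚ.∣ a x ℚ.- c ∣ + ℚ.∣ A ℚ.- C ∣
    ≤⟨ ℚₚ.+-mono-≤ (close x) (∣sumℚ-sumℚ∣≤ a c t close xs) ⟩
      t x + sumℚ (map t xs)
    ∎
    where
    open ℚₚ.≤-Reasoning
    A = sumℚ (map a xs)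
    C = sumℚ (map (λ _ → c) xs)

  halfPow-bounded : ∀ m → 0ℚ ≤ halfPow m × halfPow m ≤ 1ℚ
  halfPow-bounded zero    = ℚₚ.nonNegative⁻¹ 1ℚ , ℚₚ.≤-refl
  halfPow-bounded (suc m) =
    let 0≤h , h≤1 = halfPow-bounded m
    in ℚₚ.≤-trans (ℚₚ.≤-reflexive (sym (ℚₚ.*-zeroʳ ½))) (ℚₚ.*-monoˡ-≤-nonNeg ½ 0≤h) ,
       ℚₚ.≤-trans (ℚₚ.*-monoˡ-≤-nonNeg ½ h≤1) (ℚ.*≤* (ℤ.+≤+ (s≤s z≤n)))

  ∣p-q∣≤2 : ∀ {p q} → 0ℚ ≤ p × p ≤ 1ℚ → 0ℚ ≤ q × q ≤ 1ℚ → ℚ.∣ p ℚ.- q ∣ ≤ 1ℚ + 1ℚ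
  ∣p-q∣≤2 {p} {q} (0≤p , p≤1) (0≤q , q≤1) = ℚₚ.≤-trans (ℚₚ.∣p-q∣≤∣p∣+∣q∣ p q)
    (ℚₚ.≤-trans (ℚₚ.≤-reflexive (cong₂ _+_ (ℚₚ.0≤p⇒∣p∣≡p 0≤p) (ℚₚ.0≤p⇒∣p∣≡p 0≤q))) (ℚₚ.+-mono-≤ p≤1 q≤1))

  divℕ-suc : ∀ a {N b} → N ≡ suc b → divℕ a N ≡ fromℕ a * (ℤ.+ 1 / suc b)
  divℕ-suc a {b = b} refl = /≡fromℕ*1/ a b

  module _ (r : ℕ) (H : Hypergraph r) (m : ℕ) where

    private
      k n b : ℕ
      k = nV H
      n = suc m
      b = ℕ.pred (n ^ k)
      n^k≡1+b : n ^ k ≡ suc b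
      n^k≡1+b = sym (ℕₚ.suc-pred (n ^ k) {{ℕₚ.m^n≢0 n k}})
      q : ℚ
      q = ℤ.+ 1 / suc b
      Φ = allMaps k n
      LL = kSubsets n (r ∸ 1)
      c = halfPow ((r ∸ 1) *ℕ eH H)
      isHom : Vec (Fin n) k → Tournament n → Bool
      isHom φ σ = allB (λ e → isEdgeG r σ (image φ e)) (edges H)

    expectedDensity≡sum-Pr : expectedDensity r H n ≡ sumℚ (map (λ φ → Pr LL (isHom φ)) Φ) * q
    expectedDensity≡sum-Pr = begin
        avgOver LL (λ σ → divℕ (length (filter (λ φ → isHom φ σ Boolₚ.≟ true) Φ)) (n ^ k))
      ≡⟨ avgOver-cong LL (λ σ → trans (divℕ-suc _ n^k≡1+b)
                                      (cong (_* q) (trans (cong fromℕ (length-filter≡count (λ φ → isHom φ σ) Φ))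
                                                          (sym (sumℚ-𝟙 (λ φ → isHom φ σ) Φ))))) ⟩
        avgOver LL (λ σ → sumℚ (map (λ φ → 𝟙 (isHom φ σ)) Φ) * q)
      ≡⟨ avgOver-*ʳ LL q _ ⟩
        avgOver LL (λ σ → sumℚ (map (λ φ → 𝟙 (isHom φ σ)) Φ)) * q
      ≡⟨ cong (_* q) (avgOver-sum LL (λ φ σ → 𝟙 (isHom φ σ)) Φ) ⟩
        sumℚ (map (λ φ → Pr LL (isHom φ)) Φ) * q
      ∎
      where open ≡-Reasoning

    c≡ : c ≡ sumℚ (map (λ _ → c) Φ) * q
    c≡ = sym (begin
        sumℚ (map (λ _ → c) Φ) * q
      ≡⟨ cong (_* q) (sumℚ-const c Φ) ⟩
        fromℕ (length Φ) * c * q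
      ≡⟨ cong (λ l → fromℕ l * c * q) (trans (length-allMaps k n) n^k≡1+b) ⟩
        fromℕ (suc b) * c * q
      ≡⟨ solve 3 (λ F c q → F :* c :* q := (F :* q) :* c) refl (fromℕ (suc b)) c q ⟩
        fromℕ (suc b) * q * c
      ≡⟨ trans (cong (_* c) (fromℕ*1/≡1 b)) (ℚₚ.*-identityˡ c) ⟩
        c
      ∎)
      where open ≡-Reasoning

    -- Every injective map is a homomorphism with probability exactly c, and at
    -- most a k²/n fraction of all maps fails to be injective.
    ∣expectedDensity-c∣≤ : 2 ≤ℕ r → AdmitsGoodOrder H →
                           ℚ.∣ expectedDensity r H n ℚ.- c ∣ ≤ ℤ.+ (k *ℕ k +ℕ k *ℕ k) / n
    ∣expectedDensity-c∣≤ 2≤r good = begin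
        ℚ.∣ expectedDensity r H n ℚ.- c ∣
      ≡⟨ cong₂ (λ x y → ℚ.∣ x ℚ.- y ∣) expectedDensity≡sum-Pr c≡ ⟩
        ℚ.∣ SP * q ℚ.- SC * q ∣
      ≡⟨ cong ℚ.∣_∣ (solve 3 (λ x y q → x :* q :- y :* q := (x :- y) :* q) refl SP SC q) ⟩
        ℚ.∣ (SP ℚ.- SC) * q ∣
      ≡⟨ trans (ℚₚ.∣p*q∣≡∣p∣*∣q∣ (SP ℚ.- SC) q) (cong (ℚ.∣ SP ℚ.- SC ∣ *_) (ℚₚ.0≤p⇒∣p∣≡p 0≤q)) ⟩
        ℚ.∣ SP ℚ.- SC ∣ * q
      ≤⟨ ℚₚ.*-monoʳ-≤-nonNeg q {{ℚ.nonNegative 0≤q}} (∣sumℚ-sumℚ∣≤ (λ φ → Pr LL (isHom φ)) c _ close Φ) ⟩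
        sumℚ (map (λ φ → 𝟙 (not (injectiveᵇ φ)) + 𝟙 (not (injectiveᵇ φ))) Φ) * q
      ≡⟨ cong (_* q) (trans (sumℚ-+ (𝟙 ∘ not ∘ injectiveᵇ) (𝟙 ∘ not ∘ injectiveᵇ) Φ)
                             (trans (cong₂ _+_ (sumℚ-𝟙 (not ∘ injectiveᵇ) Φ) (sumℚ-𝟙 (not ∘ injectiveᵇ) Φ))
                                    (sym (fromℕ-+ B B)))) ⟩
        fromℕ (B +ℕ B) * q
      ≡⟨ sym (/≡fromℕ*1/ (B +ℕ B) b) ⟩
        ℤ.+ (B +ℕ B) / suc b
      ≤⟨ /-mono-≤ (B +ℕ B) b (k *ℕ k +ℕ k *ℕ k) m cross-multiplied ⟩
        ℤ.+ (k *ℕ k +ℕ k *ℕ k) / n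
      ∎
      where
      open ℚₚ.≤-Reasoning
      SP = sumℚ (map (λ φ → Pr LL (isHom φ)) Φ)
      SC = sumℚ (map (λ _ → c) Φ)
      B = #nonInjective k n
      0≤q : 0ℚ ≤ q
      0≤q = /-mono-≤ 0 0 1 b z≤n
      close : ∀ φ → ℚ.∣ Pr LL (isHom φ) ℚ.- c ∣ ≤ 𝟙 (not (injectiveᵇ φ)) + 𝟙 (not (injectiveᵇ φ))
      close φ with injectiveᵇ φ in injective
      ... | true  = ℚₚ.≤-reflexive (trans (cong (λ p → ℚ.∣ p ℚ.- c ∣)
                                                (Pr-allImageEdges 2≤r H good φ (injectiveᵇ-sound φ injective)))
                                         (cong ℚ.∣_∣ (ℚₚ.+-inverseʳ c)))
      ... | false = ∣p-q∣≤2 (Pr-bounded LL (isHom φ)) (halfPow-bounded ((r ∸ 1) *ℕ eH H))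
      cross-multiplied : (B +ℕ B) *ℕ n ≤ℕ (k *ℕ k +ℕ k *ℕ k) *ℕ suc b
      cross-multiplied = ℕₚ.≤-trans (ℕₚ.≤-reflexive (ℕₚ.*-distribʳ-+ n B B))
        (ℕₚ.≤-trans (ℕₚ.+-mono-≤ (#nonInjective*n≤k²n^k k n) (#nonInjective*n≤k²n^k k n))
          (ℕₚ.≤-reflexive (trans (sym (ℕₚ.*-distribʳ-+ (n ^ k) (k *ℕ k) (k *ℕ k))) (cong ((k *ℕ k +ℕ k *ℕ k) *ℕ_) n^k≡1+b))))

  expectedDensity-converges : ∀ {r} → 2 ≤ℕ r → (H : Hypergraph r) → AdmitsGoodOrder H →
                              ConvergesTo (expectedDensity r H) (halfPow ((r ∸ 1) *ℕ eH H))
  expectedDensity-converges {r} 2≤r H good =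
    ConvergesTo-O[1/n] (expectedDensity r H) _ (nV H *ℕ nV H +ℕ nV H *ℕ nV H) (λ m → ∣expectedDensity-c∣≤ r H m 2≤r good)

open import Data.Nat using (_≤_; _*_)

lemma3p8 : (r : ℕ) → 3 ≤ r →
    ConvergesTo (expectedDensity r (Kr r)) (halfPow (r ∸ 1))
    × ((H : Hypergraph r) → AdmitsGoodOrder H →
    ConvergesTo (expectedDensity r H) (halfPow ((r ∸ 1) * eH H)))
lemma3p8 r 3≤r =
  subst (ConvergesTo (expectedDensity r (Kr r))) (cong halfPow (ℕₚ.*-identityʳ (r ∸ 1)))
        (expectedDensity-converges 2≤r (Kr r) Kr-goodOrder)
  , expectedDensity-converges 2≤r
  where
  2≤r : 2 ≤ r
  2≤r = ℕₚ.≤-trans (ℕₚ.n≤1+n 2) 3≤r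
  Kr-goodOrder : AdmitsGoodOrder (Kr r)
  Kr-goodOrder = edges (Kr r) , ↭-refl , λ { zero zero _ () }
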